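{- Let a moding be fixed. If $P$ is a program all of whose clauses are tidy and $Q$ is a tidy query, then $P$ with $Q$ is occur-check free under any selection rule.
   Context: A moding assigns to each argument position of each predicate either $+$ (input) or $-$ (output); for an atom we write $p(s;t)$ with $s$ the terms in input positions and $t$ the terms in output positions. A syntactic object is linear if no variable occurs in it more than once. A query is output linear (input linear) if the sequence of terms in its output (input) positions is linear. For a query $Q=A_1,\ldots,A_n$, $A_i\to_Q A_j$ iff some variable occurs in an output position of $A_i$ and in an input position of $A_j$. A query is tidy if it is output linear and $\to_Q$ is acyclic. A clause $H\gets Q$ is tidy if $Q$ is tidy, $H$ is input linear, and no variable from an input position of $H$ occurs in an output position of $Q$. The Martelli–Montanari algorithm (MMA) unifies a finite set of equations $s\doteq t$ by repeatedly choosing nondeterministically an equation and applying: (1) $f(s_1,\ldots,s_n)\doteq f(t_1,\ldots,t_n)$: replace by $s_1\doteq t_1,\ldots,s_n\doteq t_n$; (2) $f(\ldots)\doteq g(\ldots)$ with $f\neq g$: halt with failure; (3) $X\doteq X$: delete; (4) $t\doteq X$ with $t$ not a variable: replace by $X\doteq t$; (5) $X\doteq t$ with $X\notin Var(t)$ and $X$ occurring elsewhere: apply $\{X/t\}$ to all other equations; (6) $X\doteq t$ with $X\in Var(t)$, $X\neq t$: halt with failure. An equation set is NSTO if action (6) is performed in no run of MMA on it. In an SLD-tree for $P$ with $Q$, a unification of $A$ and $H$ is available if $A$ is a selected atom of a query in the tree and $H$ is a standardized-apart head of a clause of $P$ with the same predicate symbol. $P$ with $Q$ is occur-check free (under a selection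 rule) if every unification $\{A\doteq H\}$ available in the SLD-tree for $P$ with $Q$ is NSTO. -}

module Defs where

open import Data.Nat using (ℕ; zero; suc; _≤_; _≡ᵇ_)
open import Data.Bool using (if_then_else_)
open import Data.Fin using (Fin; toℕ)
open import Data.List using (List; []; _∷_; _++_; length; map; concatMap; zip; take; drop; lookup)
open import Data.List.Membership.Propositional using (_∈_; _∉_)
open import Data.List.Relation.Unary.Unique.Propositional using (Unique)
open import Data.Product using (Σ; ∃; _×_; _,_)
open import Relation.Nullary using (¬_)
open import Relation.Binary.PropositionalEquality using (_≡_; _≢_)
open import Relation.Binary.Construct.Closure.Transitive using (TransClosure)
open import Relation.Binary.Construct.Closure.ReflexiveTransitive using (Star)

-- Terms, atoms, clauses, programs
-- Variables are natural numbers.  A function symbol is a name (ℕ)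
-- together with its arity (the number of arguments).

data Term : Set where
  var : ℕ → Term
  fn  : ℕ → List Term → Term

mutual
  varsT : Term → List ℕ
  varsT (var x)   = x ∷ []
  varsT (fn f ts) = varsL ts

  varsL : List Term → List ℕ
  varsL []       = []
  varsL (t ∷ ts) = varsT t ++ varsL ts

-- substitutions (applied to all variables; see IsSubstitution for finiteness)
Subst : Set
Subst = ℕ → Term

mutual
  sub : Subst → Term → Term
  sub θ (var x)   = θ x
  sub θ (fn f ts) = fn f (subL θ ts)

  subL : Subst → List Term → List Term
  subL θ []       = []
  subL θ (t ∷ ts) = sub θ t ∷ subL θ ts

-- a substitution in the usual sense has finite domain
IsSubstitution : Subst → Set
IsSubstitution θ = Σ ℕ λ N → ∀ x → N ≤ x → θ x ≡ var x

bind : ℕ → Term → Subst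
bind x t y = if y ≡ᵇ x then t else var y

-- Atoms p(t1,...,tn): predicate name and argument list.  The predicate
-- symbol is the pair (name, arity).
record Atom : Set where
  constructor atom
  field
    pred : ℕ
    args : List Term
open Atom public

SamePred : Atom → Atom → Set
SamePred A B = (pred A ≡ pred B) × (length (args A) ≡ length (args B))

-- an atom viewed as a term, so that {A ≐ H} is an equation set for MMA
atomTerm : Atom → Term
atomTerm A = fn (pred A) (args A)

subA : Subst → Atom → Atom
subA θ A = atom (pred A) (subL θ (args A))

Query : Set
Query = List Atom

record Clause : Set where
  constructor _⇐_
  field
    head : Atom
    body : Query
open Clause public

Program : Set
Program = List Clause

atomVars : Atom → List ℕ
atomVars A = varsL (args A)

queryVars : Query → List ℕ
queryVars = concatMap atomVars

clauseVars : Clause → List ℕ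
clauseVars c = atomVars (head c) ++ queryVars (body c)

data Mode : Set where
  In Out : Mode

-- a moding assigns a mode to each argument position (0-based) of each
-- predicate symbol (name, arity)
Moding : Set
Moding = ℕ → ℕ → ℕ → Mode

pick : Mode → (ℕ → Mode) → List Term → List Term
pick md f [] = []
pick In  f (t ∷ ts) with f 0
... | In  = t ∷ pick In (λ i → f (suc i)) ts
... | Out = pick In (λ i → f (suc i)) ts
pick Out f (t ∷ ts) with f 0
... | In  = pick Out (λ i → f (suc i)) ts
... | Out = t ∷ pick Out (λ i → f (suc i)) ts

module _ (m : Moding) where

  ins : Atom → List Term
  ins A = pick In (m (pred A) (length (args A))) (args A)

  outs : Atom → List Term
  outs A = pick Out (m (pred A) (length (args A))) (args A)

  LinearTerms : List Term → Set
  LinearTerms ts = Unique (varsL ts)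

  OutputLinear : Query → Set
  OutputLinear Q = LinearTerms (concatMap outs Q)

  InputLinear : Query → Set
  InputLinear Q = LinearTerms (concatMap ins Q)

  Arrow : (Q : Query) → Fin (length Q) → Fin (length Q) → Set
  Arrow Q i j = ∃ λ x → (x ∈ varsL (outs (lookup Q i))) × (x ∈ varsL (ins (lookup Q j)))

  Acyclic : Query → Set
  Acyclic Q = ∀ i → ¬ TransClosure (Arrow Q) i i

  TidyQuery : Query → Set
  TidyQuery Q = OutputLinear Q × Acyclic Q

  TidyClause : Clause → Set
  TidyClause (H ⇐ Q) =
    TidyQuery Q × InputLinear (H ∷ []) ×
    (∀ x → x ∈ varsL (ins H) → x ∉ varsL (concatMap outs Q))

-- Martelli–Montanari algorithm (nondeterministic), equation sets as lists

Eqn : Set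
Eqn = Term × Term

Eqns : Set
Eqns = List Eqn

eqnsVars : Eqns → List ℕ
eqnsVars [] = []
eqnsVars ((s , t) ∷ E) = varsT s ++ varsT t ++ eqnsVars E

subEqns : Subst → Eqns → Eqns
subEqns θ = map (λ { (s , t) → (sub θ s , sub θ t) })

-- one non-halting MMA action on a chosen equation
data MMStep : Eqns → Eqns → Set where
  decompose : ∀ L R f ss ts → length ss ≡ length ts →
    MMStep (L ++ (fn f ss , fn f ts) ∷ R) (L ++ zip ss ts ++ R)
  delete : ∀ L R x →
    MMStep (L ++ (var x , var x) ∷ R) (L ++ R)
  swap : ∀ L R f ts x →
    MMStep (L ++ (fn f ts , var x) ∷ R) (L ++ (var x , fn f ts) ∷ R)
  eliminate : ∀ L R x t → x ∉ varsT t → x ∈ eqnsVars (L ++ R) →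
    MMStep (L ++ (var x , t) ∷ R)
           (subEqns (bind x t) L ++ (var x , t) ∷ subEqns (bind x t) R)

OccursCheckApplicable : Eqns → Set
OccursCheckApplicable E =
  ∃ λ L → ∃ λ R → ∃ λ x → ∃ λ t →
    (E ≡ L ++ (var x , t) ∷ R) × (x ∈ varsT t) × (t ≢ var x)

NSTO : Eqns → Set
NSTO E = ∀ E′ → Star MMStep E E′ → ¬ OccursCheckApplicable E′

record Renaming : Set where
  field
    fwd bwd : ℕ → ℕ
    fwd-bwd : ∀ x → fwd (bwd x) ≡ x
    bwd-fwd : ∀ x → bwd (fwd x) ≡ x
    bound   : ℕ
    support : ∀ x → bound ≤ x → fwd x ≡ x
open Renaming public

renameClause : Renaming → Clause → Clause
renameClause ρ (H ⇐ B) = subA θ H ⇐ map (subA θ) B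
  where θ : Subst
        θ x = var (fwd ρ x)

Variant : Clause → Clause → Set
Variant c′ c = ∃ λ ρ → c′ ≡ renameClause ρ c

Disjoint : List ℕ → List ℕ → Set
Disjoint xs ys = ∀ x → x ∈ xs → x ∉ ys

Unifier : Subst → Atom → Atom → Set
Unifier θ A B = sub θ (atomTerm A) ≡ sub θ (atomTerm B)

MGU : Subst → Atom → Atom → Set
MGU θ A B = IsSubstitution θ × Unifier θ A B ×
  (∀ σ → IsSubstitution σ → Unifier σ A B →
     ∃ λ δ → IsSubstitution δ × (∀ x → σ x ≡ sub δ (θ x)))

-- A selection rule selects, given the initial fragment of the derivation
-- (the queries so far, most recent first) and the current nonempty query
-- A ∷ Q, an atom position in it.
SelectionRule : Set
SelectionRule = List Query → (A : Atom) → (Q : Query) → Fin (length (A ∷ Q))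

replaceAt : (Q : Query) → Fin (length Q) → Query → Query
replaceAt Q i B = take (toℕ i) Q ++ B ++ drop (suc (toℕ i)) Q

-- nodes of SLD-trees for P with Q0 via R:
-- InTree P R Q0 hist Q  means Q is a node reached along a derivation
-- whose earlier queries are hist (most recent first)
data InTree (P : Program) (R : SelectionRule) (Q₀ : Query) : List Query → Query → Set where
  root : InTree P R Q₀ [] Q₀
  step : ∀ {hist A Q} → InTree P R Q₀ hist (A ∷ Q) →
    ∀ c c′ θ → c ∈ P → Variant c′ c → Disjoint (clauseVars c′) (queryVars (A ∷ Q)) →
    MGU θ (lookup (A ∷ Q) (R hist A Q)) (head c′) →
    InTree P R Q₀ ((A ∷ Q) ∷ hist)
      (map (subA θ) (replaceAt (A ∷ Q) (R hist A Q) (body c′)))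

OccurCheckFree : Program → Query → SelectionRule → Set
OccurCheckFree P Q₀ R =
  ∀ hist A Q → InTree P R Q₀ hist (A ∷ Q) →
  ∀ c c′ → c ∈ P → Variant c′ c → Disjoint (clauseVars c′) (queryVars (A ∷ Q)) →
  SamePred (lookup (A ∷ Q) (R hist A Q)) (head c′) →
  NSTO ((atomTerm (lookup (A ∷ Q) (R hist A Q)) , atomTerm (head c′)) ∷ [])

{-# OPTIONS --safe #-}
-- A query is ranked when its atoms p(s;t), read as equations s ≐ t and given ranks, form a
-- stratified system: no variable occurs twice on the right, and no left side shares a variable
-- with a right side of equal or higher rank.  A tidy query is ranked along its acyclic relation →_Q.
-- Stratified systems never admit the occur-check action (6), and every other MMA action keeps a
-- system stratified; the equations between a selected atom and a renamed tidy clause head,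
-- oriented by mode, form such a system, so every available unification is NSTO.
-- Resolution keeps queries ranked: inserting those equations between the atoms around the selected
-- one and the clause body gives a stratified system, a unification run preserving stratification
-- solves it and so computes an mgu that maps the resolvent to a ranked query, and any other mgu
-- differs from that one by a renaming.

module Submission where

open import Defs
open import Data.Bool using (Bool; true; false; not; T)
open import Data.Empty using (⊥; ⊥-elim)
open import Function using (_∘_; id)
open import Data.Fin using (Fin; toℕ; punchIn; punchOut) renaming (zero to fzero; suc to fsuc)
open import Data.Fin.Properties using (any?; all?; ¬∀⟶∃¬; pigeonhole; punchIn-punchOut) renaming (_≟_ to _≟ᶠ_)
open import Data.List using (List; []; _∷_; _++_; length; map; concatMap; zip; take; drop; lookup; tabulate)
open import Data.List.Membership.Propositional using (_∈_; _∉_; find; lose)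
open import Data.List.Membership.Propositional.Properties
  using (∈-++⁺ˡ; ∈-++⁺ʳ; ∈-++⁻; ∈-map⁺; ∈-map⁻; ∈-lookup; ∈-tabulate⁻; ∈-insert)
open import Data.List.Properties using (map-++; ++-assoc; ++-identityʳ; ∷-injective; map-tabulate; tabulate-lookup)
open import Data.List.Relation.Unary.All using (All; []; _∷_)
open import Data.List.Relation.Unary.All.Properties using (¬Any⇒All¬; All¬⇒¬Any)
import Data.List.Relation.Unary.All as All
import Data.List.Relation.Unary.All.Properties as AllP
open import Data.List.Relation.Unary.Any using (here; there) renaming (any? to anyᴸ?)
open import Data.List.Relation.Unary.Unique.Propositional using (Unique; []; _∷_)
import Data.List.Relation.Unary.Unique.Propositional.Properties as Unique
open import Data.Nat using (ℕ; zero; suc; _≤_; _<_; _+_; _*_; _⊔_; z≤n; s≤s; _≡ᵇ_)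
open import Data.Nat.Properties
open import Data.List.Membership.DecPropositional _≟_ using (_∈?_)
open import Data.Product using (Σ; ∃; ∃₂; _×_; _,_; proj₁; proj₂)
open import Data.Sum using (_⊎_; inj₁; inj₂; [_,_]′)
open import Relation.Nullary using (¬_; Dec; yes; no)
open import Relation.Nullary.Decidable using (¬?; decidable-stable; map′)
open import Relation.Binary.PropositionalEquality
open import Relation.Binary.Construct.Closure.ReflexiveTransitive using (Star; ε; _◅_)
open import Relation.Binary.Construct.Closure.Transitive using (TransClosure; [_]; _∷_)

infix 4 _#_

_#_ : List ℕ → List ℕ → Set
xs # ys = ∀ {z} → z ∈ xs → z ∈ ys → ⊥

Unique-∷⁻ : ∀ {x : ℕ} {xs} → Unique (x ∷ xs) → x ∉ xs × Unique xs
Unique-∷⁻ (x∉ ∷ u) = All¬⇒¬Any x∉ , u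

Unique-∷⁺ : ∀ {x : ℕ} {xs} → x ∉ xs → Unique xs → Unique (x ∷ xs)
Unique-∷⁺ x∉ u = ¬Any⇒All¬ _ x∉ ∷ u

Unique-++⁺ : ∀ {xs ys : List ℕ} → Unique xs → Unique ys → xs # ys → Unique (xs ++ ys)
Unique-++⁺ u v d = Unique.++⁺ u v (λ (p , q) → d p q)

Unique-++⁻ : ∀ xs {ys : List ℕ} → Unique (xs ++ ys) → Unique xs × Unique ys × xs # ys
Unique-++⁻ [] u = [] , u , λ ()
Unique-++⁻ (x ∷ xs) u with Unique-∷⁻ u
... | x∉ , u′ with Unique-++⁻ xs u′
... | uxs , uys , d = Unique-∷⁺ (x∉ ∘ ∈-++⁺ˡ) uxs , uys , λ
  { (here refl) q → x∉ (∈-++⁺ʳ xs q) ; (there p) q → d p q }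

Unique-++-comm : ∀ xs {ys : List ℕ} → Unique (xs ++ ys) → Unique (ys ++ xs)
Unique-++-comm xs u with Unique-++⁻ xs u
... | uxs , uys , d = Unique-++⁺ uys uxs (λ p q → d q p)

varsL-++ : ∀ ss ts → varsL (ss ++ ts) ≡ varsL ss ++ varsL ts
varsL-++ [] ts = refl
varsL-++ (s ∷ ss) ts = trans (cong (varsT s ++_) (varsL-++ ss ts)) (sym (++-assoc (varsT s) (varsL ss) (varsL ts)))

varsL-[_] : ∀ t → varsL (t ∷ []) ≡ varsT t
varsL-[ t ] = ++-identityʳ (varsT t)

∈-varsL⁺ : ∀ {t ts z} → t ∈ ts → z ∈ varsT t → z ∈ varsL ts
∈-varsL⁺ {ts = t ∷ ts} (here refl) p = ∈-++⁺ˡ p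
∈-varsL⁺ {ts = t ∷ ts} (there q) p = ∈-++⁺ʳ (varsT t) (∈-varsL⁺ q p)

∈-varsL⁻ : ∀ ts {z} → z ∈ varsL ts → ∃ λ t → t ∈ ts × z ∈ varsT t
∈-varsL⁻ (t ∷ ts) p with ∈-++⁻ (varsT t) p
... | inj₁ q = t , here refl , q
... | inj₂ q with ∈-varsL⁻ ts q
... | u , m , r = u , there m , r

imageVars : Subst → List ℕ → List ℕ
imageVars σ [] = []
imageVars σ (y ∷ ys) = varsT (σ y) ++ imageVars σ ys

imageVars-++ : ∀ σ xs ys → imageVars σ (xs ++ ys) ≡ imageVars σ xs ++ imageVars σ ys
imageVars-++ σ [] ys = refl
imageVars-++ σ (x ∷ xs) ys =
  trans (cong (varsT (σ x) ++_) (imageVars-++ σ xs ys)) (sym (++-assoc (varsT (σ x)) (imageVars σ xs) (imageVars σ ys)))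

∈-imageVars⁻ : ∀ σ xs {z} → z ∈ imageVars σ xs → ∃ λ y → y ∈ xs × z ∈ varsT (σ y)
∈-imageVars⁻ σ (y ∷ xs) p with ∈-++⁻ (varsT (σ y)) p
... | inj₁ q = y , here refl , q
... | inj₂ q with ∈-imageVars⁻ σ xs q
... | y′ , m , r = y′ , there m , r

∈-imageVars⁺ : ∀ σ {xs y z} → y ∈ xs → z ∈ varsT (σ y) → z ∈ imageVars σ xs
∈-imageVars⁺ σ {y ∷ xs} (here refl) p = ∈-++⁺ˡ p
∈-imageVars⁺ σ {y ∷ xs} (there m) p = ∈-++⁺ʳ (varsT (σ y)) (∈-imageVars⁺ σ m p)

mutual
  varsT-sub : ∀ σ t → varsT (sub σ t) ≡ imageVars σ (varsT t)
  varsT-sub σ (var x) = sym (++-identityʳ (varsT (σ x)))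
  varsT-sub σ (fn f ts) = varsL-subL σ ts

  varsL-subL : ∀ σ ts → varsL (subL σ ts) ≡ imageVars σ (varsL ts)
  varsL-subL σ [] = refl
  varsL-subL σ (t ∷ ts) =
    trans (cong₂ _++_ (varsT-sub σ t) (varsL-subL σ ts)) (sym (imageVars-++ σ (varsT t) (varsL ts)))

mutual
  sub-cong : ∀ {σ τ} t → (∀ {y} → y ∈ varsT t → σ y ≡ τ y) → sub σ t ≡ sub τ t
  sub-cong (var x) h = h (here refl)
  sub-cong (fn f ts) h = cong (fn f) (subL-cong ts h)

  subL-cong : ∀ {σ τ} ts → (∀ {y} → y ∈ varsL ts → σ y ≡ τ y) → subL σ ts ≡ subL τ ts
  subL-cong [] h = refl
  subL-cong (t ∷ ts) h = cong₂ _∷_ (sub-cong t (h ∘ ∈-++⁺ˡ)) (subL-cong ts (h ∘ ∈-++⁺ʳ (varsT t)))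

mutual
  sub-var : ∀ t → sub var t ≡ t
  sub-var (var x) = refl
  sub-var (fn f ts) = cong (fn f) (subL-var ts)

  subL-var : ∀ ts → subL var ts ≡ ts
  subL-var [] = refl
  subL-var (t ∷ ts) = cong₂ _∷_ (sub-var t) (subL-var ts)

sub-id : ∀ {σ} t → (∀ {y} → y ∈ varsT t → σ y ≡ var y) → sub σ t ≡ t
sub-id t h = trans (sub-cong t h) (sub-var t)

subL-id : ∀ {σ} ts → (∀ {y} → y ∈ varsL ts → σ y ≡ var y) → subL σ ts ≡ ts
subL-id ts h = trans (subL-cong ts h) (subL-var ts)

infixr 9 _∘ₛ_

_∘ₛ_ : Subst → Subst → Subst
(τ ∘ₛ σ) y = sub τ (σ y)

mutual
  sub-∘ : ∀ σ τ t → sub τ (sub σ t) ≡ sub (τ ∘ₛ σ) t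
  sub-∘ σ τ (var x) = refl
  sub-∘ σ τ (fn f ts) = cong (fn f) (subL-∘ σ τ ts)

  subL-∘ : ∀ σ τ ts → subL τ (subL σ ts) ≡ subL (τ ∘ₛ σ) ts
  subL-∘ σ τ [] = refl
  subL-∘ σ τ (t ∷ ts) = cong₂ _∷_ (sub-∘ σ τ t) (subL-∘ σ τ ts)

fn-injective : ∀ {f g ss ts} → fn f ss ≡ fn g ts → f ≡ g × ss ≡ ts
fn-injective refl = refl , refl

mutual
  sub-id⁻ : ∀ {σ} t → sub σ t ≡ t → ∀ {y} → y ∈ varsT t → σ y ≡ var y
  sub-id⁻ (var x) e (here refl) = e
  sub-id⁻ (fn f ts) e p = subL-id⁻ ts (proj₂ (fn-injective e)) p

  subL-id⁻ : ∀ {σ} ts → subL σ ts ≡ ts → ∀ {y} → y ∈ varsL ts → σ y ≡ var y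
  subL-id⁻ (t ∷ ts) e p with ∷-injective e | ∈-++⁻ (varsT t) p
  ... | e₁ , _ | inj₁ q = sub-id⁻ t e₁ q
  ... | _ , e₂ | inj₂ q = subL-id⁻ ts e₂ q

length-subL : ∀ σ ts → length (subL σ ts) ≡ length ts
length-subL σ [] = refl
length-subL σ (t ∷ ts) = cong suc (length-subL σ ts)

subL-unifier⇒length≡ : ∀ {σ ss ts} → subL σ ss ≡ subL σ ts → length ss ≡ length ts
subL-unifier⇒length≡ {σ} {ss} {ts} e = trans (sym (length-subL σ ss)) (trans (cong length e) (length-subL σ ts))

IsVar : Term → Set
IsVar u = ∃ λ w → u ≡ var w

sub≡var⇒IsVar : ∀ θ u {w} → sub θ u ≡ var w → IsVar u
sub≡var⇒IsVar θ (var x) e = x , refl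

bind-case : ∀ x t y → (y ≡ x × bind x t y ≡ t) ⊎ (y ≢ x × bind x t y ≡ var y)
bind-case x t y with y ≡ᵇ x in eq
... | true = inj₁ (≡ᵇ⇒≡ y x (subst T (sym eq) _) , refl)
... | false = inj₂ ((λ e → subst T eq (≡⇒≡ᵇ y x e)) , refl)

bind-self : ∀ x t → bind x t x ≡ t
bind-self x t with bind-case x t x
... | inj₁ (_ , e) = e
... | inj₂ (x≢x , _) = ⊥-elim (x≢x refl)

bind-other : ∀ x t {y} → y ≢ x → bind x t y ≡ var y
bind-other x t {y} y≢x with bind-case x t y
... | inj₁ (y≡x , _) = ⊥-elim (y≢x y≡x)
... | inj₂ (_ , e) = e

∈-imageVars-bind⁻ : ∀ x t {xs z} → z ∈ imageVars (bind x t) xs → (z ∈ xs × z ≢ x) ⊎ (z ∈ varsT t × x ∈ xs)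
∈-imageVars-bind⁻ x t {xs} p with ∈-imageVars⁻ (bind x t) xs p
... | y , m , q with bind-case x t y
... | inj₁ (refl , e) = inj₂ (subst (λ u → _ ∈ varsT u) e q , m)
... | inj₂ (y≢x , e) with subst (λ u → _ ∈ varsT u) e q
... | here refl = inj₁ (m , y≢x)

bind-fresh : ∀ x t u → x ∉ varsT u → sub (bind x t) u ≡ u
bind-fresh x t u x∉ = sub-id u (λ p → bind-other x t (λ { refl → x∉ p }))

bind-eliminates : ∀ x t xs → x ∉ varsT t → x ∉ imageVars (bind x t) xs
bind-eliminates x t xs x∉t p with ∈-imageVars-bind⁻ x t {xs} p
... | inj₁ (_ , x≢x) = x≢x refl
... | inj₂ (q , _) = x∉t q

imageVars-bind-fresh : ∀ x t xs → x ∉ xs → imageVars (bind x t) xs ≡ xs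
imageVars-bind-fresh x t [] x∉ = refl
imageVars-bind-fresh x t (y ∷ xs) x∉ rewrite bind-other x t {y} (λ e → x∉ (here (sym e))) =
  cong (y ∷_) (imageVars-bind-fresh x t xs (λ p → x∉ (there p)))

IsSubstitution-var : IsSubstitution var
IsSubstitution-var = 0 , λ x _ → refl

IsSubstitution-bind : ∀ x t → IsSubstitution (bind x t)
IsSubstitution-bind x t = suc x , λ y le → bind-other x t (λ { refl → <-irrefl refl le })

IsSubstitution-∘ : ∀ {τ σ} → IsSubstitution τ → IsSubstitution σ → IsSubstitution (τ ∘ₛ σ)
IsSubstitution-∘ {τ} {σ} (N , h) (M , g) = N ⊔ M , λ y le →
  trans (cong (sub τ) (g y (≤-trans (m≤n⊔m N M) le))) (h y (≤-trans (m≤m⊔n N M) le))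

-- Stratified systems of blocks

record Block : Set where
  constructor block
  field
    lhs rhs : List Term
    rank    : ℕ
open Block

lhsVars rhsVars : Block → List ℕ
lhsVars e = varsL (lhs e)
rhsVars e = varsL (rhs e)

allRhsVars : List Block → List ℕ
allRhsVars [] = []
allRhsVars (e ∷ es) = rhsVars e ++ allRhsVars es

allRhsVars-++ : ∀ es fs → allRhsVars (es ++ fs) ≡ allRhsVars es ++ allRhsVars fs
allRhsVars-++ [] fs = refl
allRhsVars-++ (e ∷ es) fs =
  trans (cong (rhsVars e ++_) (allRhsVars-++ es fs)) (sym (++-assoc (rhsVars e) (allRhsVars es) (allRhsVars fs)))

∈-allRhsVars⁺ : ∀ {e es z} → e ∈ es → z ∈ rhsVars e → z ∈ allRhsVars es
∈-allRhsVars⁺ {es = e ∷ es} (here refl) p = ∈-++⁺ˡ p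
∈-allRhsVars⁺ {es = e ∷ es} (there m) p = ∈-++⁺ʳ (rhsVars e) (∈-allRhsVars⁺ m p)

∈-allRhsVars⁻ : ∀ es {z} → z ∈ allRhsVars es → ∃ λ e → e ∈ es × z ∈ rhsVars e
∈-allRhsVars⁻ (e ∷ es) p with ∈-++⁻ (rhsVars e) p
... | inj₁ q = e , here refl , q
... | inj₂ q with ∈-allRhsVars⁻ es q
... | e′ , m , r = e′ , there m , r

-- A block stands for equations between its left and right terms; an atom p(s;t) becomes s ≐ t.
Layered : List Block → Set
Layered es = ∀ {a b} → a ∈ es → b ∈ es → rank a ≤ rank b → lhsVars a # rhsVars b

Stratified : List Block → Set
Stratified es = Unique (allRhsVars es) × Layered es

Stratified⇒lhs#rhs : ∀ {es a} → Stratified es → a ∈ es → lhsVars a # rhsVars a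
Stratified⇒lhs#rhs (_ , layered) m = layered m m ≤-refl

Stratified-++⁻ˡ : ∀ es {fs} → Stratified (es ++ fs) → Stratified es
Stratified-++⁻ˡ es {fs} (u , layered) =
  proj₁ (Unique-++⁻ (allRhsVars es) (subst Unique (allRhsVars-++ es fs) u)) ,
  λ ma mb → layered (∈-++⁺ˡ ma) (∈-++⁺ˡ mb)

subB : Subst → Block → Block
subB σ (block l r k) = block (subL σ l) (subL σ r) k

lhsVars-sub : ∀ σ e → lhsVars (subB σ e) ≡ imageVars σ (lhsVars e)
lhsVars-sub σ e = varsL-subL σ (lhs e)

rhsVars-sub : ∀ σ e → rhsVars (subB σ e) ≡ imageVars σ (rhsVars e)
rhsVars-sub σ e = varsL-subL σ (rhs e)

allRhsVars-sub : ∀ σ es → allRhsVars (map (subB σ) es) ≡ imageVars σ (allRhsVars es)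
allRhsVars-sub σ [] = refl
allRhsVars-sub σ (e ∷ es) =
  trans (cong₂ _++_ (rhsVars-sub σ e) (allRhsVars-sub σ es)) (sym (imageVars-++ σ (rhsVars e) (allRhsVars es)))

∈-++-skip : ∀ {A : Set} (xs : List A) {ys a} → a ∈ xs ++ ys → ∀ e → a ∈ xs ++ e ∷ ys
∈-++-skip xs m e with ∈-++⁻ xs m
... | inj₁ p = ∈-++⁺ˡ p
... | inj₂ p = ∈-++⁺ʳ xs (there p)

rhsVars-apart : ∀ X {Y} e {b} → Unique (allRhsVars (X ++ e ∷ Y)) → b ∈ X ++ Y → rhsVars e # rhsVars b
rhsVars-apart X {Y} e {b} u m p q with Unique-++⁻ (allRhsVars X) (subst Unique (allRhsVars-++ X (e ∷ Y)) u)
... | _ , u₂ , d with ∈-++⁻ X m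
... | inj₁ mx = d (∈-allRhsVars⁺ mx q) (∈-++⁺ˡ p)
... | inj₂ my = proj₂ (proj₂ (Unique-++⁻ (rhsVars e) u₂)) p (∈-allRhsVars⁺ my q)

Covers : List Block → List Block → Set
Covers new old = ∀ {a} → a ∈ new → ∃ λ a′ → a′ ∈ old × rank a ≡ rank a′ ×
  (∀ {z} → z ∈ lhsVars a → z ∈ lhsVars a′) × (∀ {z} → z ∈ rhsVars a → z ∈ rhsVars a′)

Layered-covers : ∀ {new old} → Covers new old → Layered old → Layered new
Layered-covers cover layered ma mb le p q with cover ma | cover mb
... | a′ , ma′ , ra , la , _ | b′ , mb′ , rb , _ , rb′ =
  layered ma′ mb′ (subst₂ _≤_ ra rb le) (la p) (rb′ q)

zipBlocks : ℕ → List Term → List Term → List Block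
zipBlocks k (l ∷ ls) (r ∷ rs) = block (l ∷ []) (r ∷ []) k ∷ zipBlocks k ls rs
zipBlocks k _ _ = []

allRhsVars-zipBlocks : ∀ k ls rs → length ls ≡ length rs → allRhsVars (zipBlocks k ls rs) ≡ varsL rs
allRhsVars-zipBlocks k [] [] _ = refl
allRhsVars-zipBlocks k (l ∷ ls) (r ∷ rs) e =
  cong₂ _++_ varsL-[ r ] (allRhsVars-zipBlocks k ls rs (suc-injective e))

∈-zipBlocks⁻ : ∀ k ls rs {a} → a ∈ zipBlocks k ls rs →
  ∃₂ λ l r → a ≡ block (l ∷ []) (r ∷ []) k × l ∈ ls × r ∈ rs
∈-zipBlocks⁻ k (l ∷ ls) (r ∷ rs) (here refl) = l , r , refl , here refl , here refl
∈-zipBlocks⁻ k (l ∷ ls) (r ∷ rs) (there m) with ∈-zipBlocks⁻ k ls rs m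
... | l′ , r′ , e , ml , mr = l′ , r′ , e , there ml , there mr

zipBlocks-covers : ∀ X Y {f g ls rs k} →
  Covers (X ++ zipBlocks k ls rs ++ Y) (X ++ block (fn f ls ∷ []) (fn g rs ∷ []) k ∷ Y)
zipBlocks-covers X Y {k = k} {a} m with ∈-++⁻ X m
... | inj₁ mx = a , ∈-++⁺ˡ mx , refl , id , id
zipBlocks-covers X Y {ls = ls} {rs} {k} {a} m | inj₂ m₂ with ∈-++⁻ (zipBlocks k ls rs) m₂
... | inj₂ my = a , ∈-++⁺ʳ X (there my) , refl , id , id
... | inj₁ mz with ∈-zipBlocks⁻ k ls rs mz
... | l , r , refl , ml , mr = _ , ∈-insert X , refl ,
      (λ p → ∈-++⁺ˡ (∈-varsL⁺ ml (subst (_ ∈_) varsL-[ l ] p))) ,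
      (λ p → ∈-++⁺ˡ (∈-varsL⁺ mr (subst (_ ∈_) varsL-[ r ] p)))

Stratified-decompose : ∀ X Y {f g ls rs k} → length ls ≡ length rs →
  Stratified (X ++ block (fn f ls ∷ []) (fn g rs ∷ []) k ∷ Y) → Stratified (X ++ zipBlocks k ls rs ++ Y)
Stratified-decompose X Y {f} {g} {ls} {rs} {k} len (u , layered) = unique , Layered-covers (zipBlocks-covers X Y) layered
  where
  unique : Unique (allRhsVars (X ++ zipBlocks k ls rs ++ Y))
  unique = subst Unique (sym (begin
    allRhsVars (X ++ zipBlocks k ls rs ++ Y)
      ≡⟨ allRhsVars-++ X (zipBlocks k ls rs ++ Y) ⟩
    allRhsVars X ++ allRhsVars (zipBlocks k ls rs ++ Y)
      ≡⟨ cong (allRhsVars X ++_) (allRhsVars-++ (zipBlocks k ls rs) Y) ⟩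
    allRhsVars X ++ allRhsVars (zipBlocks k ls rs) ++ allRhsVars Y
      ≡⟨ cong (λ w → allRhsVars X ++ w ++ allRhsVars Y) (allRhsVars-zipBlocks k ls rs len) ⟩
    allRhsVars X ++ varsL rs ++ allRhsVars Y
      ≡⟨ cong (λ w → allRhsVars X ++ w ++ allRhsVars Y) (sym varsL-[ fn g rs ]) ⟩
    allRhsVars X ++ rhsVars (block (fn f ls ∷ []) (fn g rs ∷ []) k) ++ allRhsVars Y
      ≡⟨ sym (allRhsVars-++ X (_ ∷ Y)) ⟩
    allRhsVars (X ++ block (fn f ls ∷ []) (fn g rs ∷ []) k ∷ Y) ∎)) u
    where open ≡-Reasoning

Unique-imageVars-bind : ∀ x t xs → Unique xs → Unique (varsT t) → xs # varsT t → x ∉ varsT t →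
  Unique (imageVars (bind x t) xs)
Unique-imageVars-bind x t [] _ _ _ _ = []
Unique-imageVars-bind x t (y ∷ xs) u ut d x∉t with Unique-∷⁻ u | bind-case x t y
... | y∉ , u′ | inj₁ (refl , e) rewrite e | imageVars-bind-fresh x t xs y∉ =
  Unique-++-comm xs (Unique-++⁺ u′ ut (λ p q → d (there p) q))
... | y∉ , u′ | inj₂ (_ , e) rewrite e =
  Unique-∷⁺ (λ p → [ (λ (m , _) → y∉ m) , (λ (q , _) → d (here refl) q) ]′ (∈-imageVars-bind⁻ x t {xs} p))
            (Unique-imageVars-bind x t xs u′ ut (λ p q → d (there p) q) x∉t)

Unique-eliminate : ∀ x t xs ys → x ∉ varsT t → Unique (xs ++ varsT t ++ ys) →
  Unique (imageVars (bind x t) xs ++ x ∷ imageVars (bind x t) ys)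
Unique-eliminate x t xs ys x∉t u with Unique-++⁻ xs u
... | uxs , u₂ , dxs with Unique-++⁻ (varsT t) u₂
... | ut , uys , dt =
  Unique-++⁺ (Unique-imageVars-bind x t xs uxs ut (λ p q → dxs p (∈-++⁺ˡ q)) x∉t)
    (Unique-∷⁺ (bind-eliminates x t ys x∉t) (Unique-imageVars-bind x t ys uys ut (λ p q → dt q p) x∉t)) apart
  where
  apart : imageVars (bind x t) xs # (x ∷ imageVars (bind x t) ys)
  apart p (here refl) = bind-eliminates x t xs x∉t p
  apart p (there q) with ∈-imageVars-bind⁻ x t {xs} p | ∈-imageVars-bind⁻ x t {ys} q
  ... | inj₁ (a , _) | inj₁ (b , _) = dxs a (∈-++⁺ʳ (varsT t) b)
  ... | inj₁ (a , _) | inj₂ (b , _) = dxs a (∈-++⁺ˡ b)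
  ... | inj₂ (a , _) | inj₁ (b , _) = dt a b
  ... | inj₂ (_ , a) | inj₂ (_ , b) = dxs a (∈-++⁺ʳ (varsT t) b)

-- The eliminated equation x ≐ t (or t ≐ x) survives as t ≐ x, ranked above all others.
module Eliminate (X Y : List Block) (x : ℕ) (t : Term) (N : ℕ)
                 (N-above : ∀ {a} → a ∈ X ++ Y → rank a < N) where

  σ : Subst
  σ = bind x t

  solved : Block
  solved = block (t ∷ []) (var x ∷ []) N

  new : List Block
  new = map (subB σ) X ++ solved ∷ map (subB σ) Y

  ∈-new⁻ : ∀ {a} → a ∈ new → a ≡ solved ⊎ ∃ λ b → b ∈ X ++ Y × a ≡ subB σ b
  ∈-new⁻ m with ∈-++⁻ (map (subB σ) X) m
  ... | inj₁ mx with ∈-map⁻ (subB σ) mx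
  ...   | b , mb , eq = inj₂ (b , ∈-++⁺ˡ mb , eq)
  ∈-new⁻ m | inj₂ (here eq) = inj₁ eq
  ∈-new⁻ m | inj₂ (there my) with ∈-map⁻ (subB σ) my
  ...   | b , mb , eq = inj₂ (b , ∈-++⁺ʳ X mb , eq)

  allRhsVars-new : allRhsVars new ≡ imageVars σ (allRhsVars X) ++ x ∷ imageVars σ (allRhsVars Y)
  allRhsVars-new rewrite allRhsVars-++ (map (subB σ) X) (solved ∷ map (subB σ) Y)
                       | allRhsVars-sub σ X | allRhsVars-sub σ Y = refl

  x∉lhsVars : ∀ b → x ∉ varsT t → x ∉ lhsVars (subB σ b)
  x∉lhsVars b x∉t p = bind-eliminates x t (lhsVars b) x∉t (subst (x ∈_) (lhsVars-sub σ b) p)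

  Layered-new : x ∉ varsT t →
    (∀ {a b} → a ∈ X ++ Y → b ∈ X ++ Y → rank a ≤ rank b → imageVars σ (lhsVars a) # imageVars σ (rhsVars b)) →
    Layered new
  Layered-new x∉t old ma mb le p q with ∈-new⁻ ma | ∈-new⁻ mb
  ... | inj₁ refl | inj₁ refl with q
  ...   | here refl = x∉t (subst (_ ∈_) varsL-[ t ] p)
  Layered-new x∉t old ma mb le p q | inj₁ refl | inj₂ (b , mb′ , refl) = <⇒≱ (N-above mb′) le
  Layered-new x∉t old ma mb le p q | inj₂ (a , ma′ , refl) | inj₁ refl with q
  ...   | here refl = x∉lhsVars a x∉t p
  Layered-new x∉t old ma mb le p q | inj₂ (a , ma′ , refl) | inj₂ (b , mb′ , refl) =
    old ma′ mb′ le (subst (_ ∈_) (lhsVars-sub σ a) p) (subst (_ ∈_) (rhsVars-sub σ b) q)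

  eliminate-var≐t : ∀ k → Stratified (X ++ block (var x ∷ []) (t ∷ []) k ∷ Y) → Stratified new
  eliminate-var≐t k (u , layered) = unique , Layered-new x∉t old
    where
    e = block (var x ∷ []) (t ∷ []) k
    x∉t : x ∉ varsT t
    x∉t p = Stratified⇒lhs#rhs (u , layered) (∈-insert X) (here refl) (subst (_ ∈_) (sym varsL-[ t ]) p)
    unique : Unique (allRhsVars new)
    unique rewrite allRhsVars-new = Unique-eliminate x t (allRhsVars X) (allRhsVars Y) x∉t
      (subst Unique (trans (allRhsVars-++ X (e ∷ Y)) (cong (λ w → allRhsVars X ++ w ++ allRhsVars Y) varsL-[ t ])) u)
    old : ∀ {a b} → a ∈ X ++ Y → b ∈ X ++ Y → rank a ≤ rank b → imageVars σ (lhsVars a) # imageVars σ (rhsVars b)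
    old {a} {b} ma mb le p q with ∈-imageVars-bind⁻ x t {lhsVars a} p | ∈-imageVars-bind⁻ x t {rhsVars b} q
    ... | inj₁ (pa , _) | inj₁ (qb , _) = layered (∈-++-skip X ma e) (∈-++-skip X mb e) le pa qb
    ... | inj₁ (pa , _) | inj₂ (qt , xb) with k ≤? rank b
    ...   | yes k≤b = layered (∈-insert X) (∈-++-skip X mb e) k≤b (here refl) xb
    ...   | no k≰b = layered (∈-++-skip X ma e) (∈-insert X) (<⇒≤ (≤-<-trans le (≰⇒> k≰b)))
                       pa (subst (_ ∈_) (sym varsL-[ t ]) qt)
    old ma mb le p q | inj₂ (pt , _) | inj₁ (qb , _) =
      rhsVars-apart X e u mb (subst (_ ∈_) (sym varsL-[ t ]) pt) qb
    old ma mb le p q | inj₂ (_ , xa) | inj₂ (_ , xb) = layered (∈-++-skip X ma e) (∈-++-skip X mb e) le xa xb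

  eliminate-t≐var : ∀ k → Stratified (X ++ block (t ∷ []) (var x ∷ []) k ∷ Y) → Stratified new
  eliminate-t≐var k (u , layered) = unique , Layered-new x∉t old
    where
    e = block (t ∷ []) (var x ∷ []) k
    x∉t : x ∉ varsT t
    x∉t p = Stratified⇒lhs#rhs (u , layered) (∈-insert X) (subst (_ ∈_) (sym varsL-[ t ]) p) (here refl)
    u′ : Unique (allRhsVars X ++ x ∷ allRhsVars Y)
    u′ = subst Unique (allRhsVars-++ X (e ∷ Y)) u
    x∉X : x ∉ allRhsVars X
    x∉X p = proj₂ (proj₂ (Unique-++⁻ (allRhsVars X) u′)) p (here refl)
    x∉Y : x ∉ allRhsVars Y
    x∉Y = proj₁ (Unique-∷⁻ (proj₁ (proj₂ (Unique-++⁻ (allRhsVars X) u′))))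
    unique : Unique (allRhsVars new)
    unique rewrite allRhsVars-new | imageVars-bind-fresh x t (allRhsVars X) x∉X
                 | imageVars-bind-fresh x t (allRhsVars Y) x∉Y = u′
    old : ∀ {a b} → a ∈ X ++ Y → b ∈ X ++ Y → rank a ≤ rank b → imageVars σ (lhsVars a) # imageVars σ (rhsVars b)
    old {a} {b} ma mb le p q
      with subst (_ ∈_) (imageVars-bind-fresh x t (rhsVars b) (rhsVars-apart X e u mb (here refl))) q
    ... | q′ with ∈-imageVars-bind⁻ x t {lhsVars a} p
    ...   | inj₁ (pa , _) = layered (∈-++-skip X ma e) (∈-++-skip X mb e) le pa q′
    ...   | inj₂ (pt , xa) with rank a ≤? k
    ...     | yes a≤k = layered (∈-++-skip X ma e) (∈-insert X) a≤k xa (here refl)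
    ...     | no a≰k = layered (∈-insert X) (∈-++-skip X mb e) (<⇒≤ (<-≤-trans (≰⇒> a≰k) le))
                         (subst (_ ∈_) (sym varsL-[ t ]) pt) q′

-- Martelli–Montanari steps preserve stratifiability

-- An equation of an MMA equation set together with a rank and an orientation: `toEqn` is the
-- equation itself, `toBlock` reads it left-to-right if `same` holds and right-to-left otherwise.
record OEqn : Set where
  constructor oeqn
  field
    same  : Bool
    level : ℕ
    left right : Term
open OEqn

toEqn : OEqn → Eqn
toEqn (oeqn true k l r) = l , r
toEqn (oeqn false k l r) = r , l

toBlock : OEqn → Block
toBlock (oeqn o k l r) = block (l ∷ []) (r ∷ []) k

subO : Subst → OEqn → OEqn
subO σ (oeqn o k l r) = oeqn o k (sub σ l) (sub σ r)

orient : Bool → ℕ → Term → Term → OEqn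
orient true k s t = oeqn true k s t
orient false k s t = oeqn false k t s

orient-toEqn : ∀ a {s t} → toEqn a ≡ (s , t) → a ≡ orient (same a) (level a) s t
orient-toEqn (oeqn true k l r) refl = refl
orient-toEqn (oeqn false k l r) refl = refl

orient-apart : ∀ o k s t → lhsVars (toBlock (orient o k s t)) # rhsVars (toBlock (orient o k s t)) →
  varsT s # varsT t
orient-apart true k s t d p q = d (subst (_ ∈_) (sym varsL-[ s ]) p) (subst (_ ∈_) (sym varsL-[ t ]) q)
orient-apart false k s t d p q = d (subst (_ ∈_) (sym varsL-[ t ]) q) (subst (_ ∈_) (sym varsL-[ s ]) p)

map-toEqn-subO : ∀ σ os → map toEqn (map (subO σ) os) ≡ subEqns σ (map toEqn os)
map-toEqn-subO σ [] = refl
map-toEqn-subO σ (oeqn true k l r ∷ os) = cong (_ ∷_) (map-toEqn-subO σ os)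
map-toEqn-subO σ (oeqn false k l r ∷ os) = cong (_ ∷_) (map-toEqn-subO σ os)

map-toBlock-subO : ∀ σ os → map toBlock (map (subO σ) os) ≡ map (subB σ) (map toBlock os)
map-toBlock-subO σ [] = refl
map-toBlock-subO σ (oeqn o k l r ∷ os) = cong (_ ∷_) (map-toBlock-subO σ os)

zipOriented : Bool → ℕ → List Term → List Term → List OEqn
zipOriented o k (s ∷ ss) (t ∷ ts) = orient o k s t ∷ zipOriented o k ss ts
zipOriented o k _ _ = []

map-toEqn-zipOriented : ∀ o k ss ts → map toEqn (zipOriented o k ss ts) ≡ zip ss ts
map-toEqn-zipOriented o k [] ts = refl
map-toEqn-zipOriented o k (s ∷ ss) [] = refl
map-toEqn-zipOriented true k (s ∷ ss) (t ∷ ts) = cong (_ ∷_) (map-toEqn-zipOriented true k ss ts)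
map-toEqn-zipOriented false k (s ∷ ss) (t ∷ ts) = cong (_ ∷_) (map-toEqn-zipOriented false k ss ts)

map-toBlock-zipOriented : ∀ k ss ts →
  map toBlock (zipOriented true k ss ts) ≡ zipBlocks k ss ts ×
  map toBlock (zipOriented false k ss ts) ≡ zipBlocks k ts ss
map-toBlock-zipOriented k [] [] = refl , refl
map-toBlock-zipOriented k [] (t ∷ ts) = refl , refl
map-toBlock-zipOriented k (s ∷ ss) [] = refl , refl
map-toBlock-zipOriented k (s ∷ ss) (t ∷ ts) with map-toBlock-zipOriented k ss ts
... | e₁ , e₂ = cong (_ ∷_) e₁ , cong (_ ∷_) e₂

Stratified-decomposeO : ∀ X Y o k {f ss ts} → length ss ≡ length ts →
  Stratified (X ++ toBlock (orient o k (fn f ss) (fn f ts)) ∷ Y) →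
  Stratified (X ++ map toBlock (zipOriented o k ss ts) ++ Y)
Stratified-decomposeO X Y true k {ss = ss} {ts} len s
  rewrite proj₁ (map-toBlock-zipOriented k ss ts) = Stratified-decompose X Y len s
Stratified-decomposeO X Y false k {ss = ss} {ts} len s
  rewrite proj₂ (map-toBlock-zipOriented k ss ts) = Stratified-decompose X Y (sym len) s

Stratifiable : Eqns → Set
Stratifiable E = ∃ λ os → map toEqn os ≡ E × Stratified (map toBlock os)

split-toEqns : ∀ os L (p : Eqn) R → map toEqn os ≡ L ++ p ∷ R →
  ∃₂ λ osL a → ∃ λ osR → os ≡ osL ++ a ∷ osR × map toEqn osL ≡ L × toEqn a ≡ p × map toEqn osR ≡ R
split-toEqns (a ∷ os) [] p R eq with ∷-injective eq
... | e₁ , e₂ = [] , a , os , refl , refl , e₁ , e₂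
split-toEqns (a ∷ os) (q ∷ L) p R eq with ∷-injective eq
... | e₁ , e₂ with split-toEqns os L p R e₂
... | osL , b , osR , refl , q₁ , q₂ , q₃ = a ∷ osL , b , osR , refl , cong₂ _∷_ e₁ q₁ , q₂ , q₃

module Focus (L R : Eqns) (p : Eqn) (s : Stratifiable (L ++ p ∷ R)) where

  private
    parts = split-toEqns (proj₁ s) L p R (proj₁ (proj₂ s))
    facts = proj₂ (proj₂ (proj₂ parts))

  osL = proj₁ parts
  focus = proj₁ (proj₂ parts)
  osR = proj₁ (proj₂ (proj₂ parts))

  osL-toEqns : map toEqn osL ≡ L
  osL-toEqns = proj₁ (proj₂ facts)

  focus-toEqn : toEqn focus ≡ p
  focus-toEqn = proj₁ (proj₂ (proj₂ facts))

  osR-toEqns : map toEqn osR ≡ R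
  osR-toEqns = proj₂ (proj₂ (proj₂ facts))

  focus-stratified : Stratified (map toBlock osL ++ toBlock focus ∷ map toBlock osR)
  focus-stratified =
    subst Stratified (trans (cong (map toBlock) (proj₁ facts)) (map-++ toBlock osL (focus ∷ osR))) (proj₂ (proj₂ s))

  focus-oriented : focus ≡ orient (same focus) (level focus) (proj₁ p) (proj₂ p)
  focus-oriented = orient-toEqn focus focus-toEqn

  focus-apart : varsT (proj₁ p) # varsT (proj₂ p)
  focus-apart = orient-apart (same focus) (level focus) _ _
    (subst (λ a → lhsVars (toBlock a) # rhsVars (toBlock a)) focus-oriented
      (Stratified⇒lhs#rhs focus-stratified (∈-insert (map toBlock osL))))

map-++₃ : ∀ {A B : Set} (f : A → B) xs ys zs → map f (xs ++ ys ++ zs) ≡ map f xs ++ map f ys ++ map f zs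
map-++₃ f xs ys zs = trans (map-++ f xs (ys ++ zs)) (cong (map f xs ++_) (map-++ f ys zs))

maxRank : List Block → ℕ
maxRank [] = 0
maxRank (e ∷ es) = rank e ⊔ maxRank es

maxRank-≥ : ∀ {a es} → a ∈ es → rank a ≤ maxRank es
maxRank-≥ {es = e ∷ es} (here refl) = m≤m⊔n (rank e) (maxRank es)
maxRank-≥ {es = e ∷ es} (there m) = ≤-trans (maxRank-≥ m) (m≤n⊔m (rank e) (maxRank es))

step-stratifiable : ∀ {E E′} → MMStep E E′ → Stratifiable E → Stratifiable E′
step-stratifiable (decompose L R f ss ts len) s =
  osL ++ zipOriented o k ss ts ++ osR ,
  trans (map-++₃ toEqn osL _ osR) (cong₂ _++_ osL-toEqns (cong₂ _++_ (map-toEqn-zipOriented o k ss ts) osR-toEqns)) ,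
  subst Stratified (sym (map-++₃ toBlock osL _ osR))
    (Stratified-decomposeO (map toBlock osL) (map toBlock osR) o k len
      (subst (λ a → Stratified (map toBlock osL ++ toBlock a ∷ map toBlock osR)) focus-oriented focus-stratified))
  where
  open Focus L R _ s
  o = same focus
  k = level focus
step-stratifiable (delete L R x) s = ⊥-elim (Focus.focus-apart L R _ s (here refl) (here refl))
step-stratifiable (swap L R f ts x) s =
  osL ++ flipped ∷ osR ,
  trans (map-++ toEqn osL (flipped ∷ osR)) (cong₂ _++_ osL-toEqns (cong₂ _∷_ flipped-toEqn osR-toEqns)) ,
  subst Stratified (sym (map-++ toBlock osL (flipped ∷ osR))) focus-stratified
  where
  open Focus L R _ s
  flipped = oeqn (not (same focus)) (level focus) (left focus) (right focus)
  flipped-toEqn : toEqn flipped ≡ (var x , fn f ts)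
  flipped-toEqn with focus | focus-toEqn
  ... | oeqn true _ _ _ | refl = refl
  ... | oeqn false _ _ _ | refl = refl
step-stratifiable (eliminate L R x t x∉t _) s =
  map (subO (bind x t)) osL ++ solvedO ∷ map (subO (bind x t)) osR ,
  trans (map-++ toEqn (map (subO (bind x t)) osL) (solvedO ∷ _))
    (cong₂ _++_ (trans (map-toEqn-subO (bind x t) osL) (cong (subEqns (bind x t)) osL-toEqns))
                (cong (_ ∷_) (trans (map-toEqn-subO (bind x t) osR) (cong (subEqns (bind x t)) osR-toEqns)))) ,
  subst Stratified
    (sym (trans (map-++ toBlock (map (subO (bind x t)) osL) (solvedO ∷ _))
                (cong₂ _++_ (map-toBlock-subO (bind x t) osL) (cong (toBlock solvedO ∷_) (map-toBlock-subO (bind x t) osR)))))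
    (eliminated (same focus) (subst (λ a → Stratified (X ++ toBlock a ∷ Y)) focus-oriented focus-stratified))
  where
  open Focus L R _ s
  X = map toBlock osL
  Y = map toBlock osR
  N = suc (maxRank (X ++ Y))
  solvedO = oeqn false N t (var x)
  open Eliminate X Y x t N (s≤s ∘ maxRank-≥)
  eliminated : ∀ o → Stratified (X ++ toBlock (orient o (level focus) (var x) t) ∷ Y) → Stratified new
  eliminated true = eliminate-var≐t (level focus)
  eliminated false = eliminate-t≐var (level focus)

star-stratifiable : ∀ {E E′} → Star MMStep E E′ → Stratifiable E → Stratifiable E′
star-stratifiable ε s = s
star-stratifiable (st ◅ sts) s = star-stratifiable sts (step-stratifiable st s)

Stratifiable⇒¬OccursCheckApplicable : ∀ {E} → Stratifiable E → ¬ OccursCheckApplicable E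
Stratifiable⇒¬OccursCheckApplicable s (L , R , x , t , refl , x∈t , _) = Focus.focus-apart L R _ s (here refl) x∈t

++-∷≡[_] : ∀ {A : Set} (q : A) {L p R} → L ++ p ∷ R ≡ q ∷ [] → L ≡ [] × p ≡ q × R ≡ []
++-∷≡[ q ] {[]} refl = refl , refl , refl
++-∷≡[ q ] {_ ∷ []} ()
++-∷≡[ q ] {_ ∷ _ ∷ _} ()

singleton-step : ∀ {E E′ f g ss ts} → E ≡ (fn f ss , fn g ts) ∷ [] → MMStep E E′ → E′ ≡ zip ss ts
singleton-step eq (decompose L R f ss ts _) with ++-∷≡[ _ ] eq
... | refl , refl , refl = ++-identityʳ _
singleton-step eq (delete L R x) with ++-∷≡[ _ ] eq
... | _ , () , _
singleton-step eq (swap L R f ts x) with ++-∷≡[ _ ] eq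
... | _ , () , _
singleton-step eq (eliminate L R x t _ _) with ++-∷≡[ _ ] eq
... | _ , () , _

NSTO-fn≐fn : ∀ {f g ss ts} → Stratifiable (zip ss ts) → NSTO ((fn f ss , fn g ts) ∷ [])
NSTO-fn≐fn s E′ ε (L , R , x , t , eq , _) with ++-∷≡[ _ ] (sym eq)
... | _ , () , _
NSTO-fn≐fn s E′ (st ◅ sts) =
  Stratifiable⇒¬OccursCheckApplicable (star-stratifiable sts (subst Stratifiable (sym (singleton-step refl st)) s))

∈-pick⁻ : ∀ md f ts {t} → t ∈ pick md f ts → t ∈ ts
∈-pick⁻ In f (u ∷ ts) m with f 0
∈-pick⁻ In f (u ∷ ts) (here e) | In = here e
∈-pick⁻ In f (u ∷ ts) (there m) | In = there (∈-pick⁻ In _ ts m)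
∈-pick⁻ In f (u ∷ ts) m | Out = there (∈-pick⁻ In _ ts m)
∈-pick⁻ Out f (u ∷ ts) m with f 0
∈-pick⁻ Out f (u ∷ ts) m | In = there (∈-pick⁻ Out _ ts m)
∈-pick⁻ Out f (u ∷ ts) (here e) | Out = here e
∈-pick⁻ Out f (u ∷ ts) (there m) | Out = there (∈-pick⁻ Out _ ts m)

∈-varsL-pick⁻ : ∀ md f ts {z} → z ∈ varsL (pick md f ts) → z ∈ varsL ts
∈-varsL-pick⁻ md f ts p with ∈-varsL⁻ (pick md f ts) p
... | t , m , q = ∈-varsL⁺ (∈-pick⁻ md f ts m) q

∈-varsL-pick-In⊎Out : ∀ f ts {z} → z ∈ varsL ts → z ∈ varsL (pick In f ts) ⊎ z ∈ varsL (pick Out f ts)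
∈-varsL-pick-In⊎Out f (t ∷ ts) p with f 0 | ∈-++⁻ (varsT t) p
... | In | inj₁ q = inj₁ (∈-++⁺ˡ q)
... | Out | inj₁ q = inj₂ (∈-++⁺ˡ q)
... | In | inj₂ q = [ inj₁ ∘ ∈-++⁺ʳ (varsT t) , inj₂ ]′ (∈-varsL-pick-In⊎Out _ ts q)
... | Out | inj₂ q = [ inj₁ , inj₂ ∘ ∈-++⁺ʳ (varsT t) ]′ (∈-varsL-pick-In⊎Out _ ts q)

pick-subL : ∀ md f σ ts → pick md f (subL σ ts) ≡ subL σ (pick md f ts)
pick-subL md f σ [] = refl
pick-subL In f σ (t ∷ ts) with f 0
... | In = cong (_ ∷_) (pick-subL In _ σ ts)
... | Out = pick-subL In _ σ ts
pick-subL Out f σ (t ∷ ts) with f 0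
... | In = pick-subL Out _ σ ts
... | Out = cong (_ ∷_) (pick-subL Out _ σ ts)

ins-subA : ∀ m σ A → ins m (subA σ A) ≡ subL σ (ins m A)
ins-subA m σ A rewrite length-subL σ (args A) = pick-subL In _ σ (args A)

outs-subA : ∀ m σ A → outs m (subA σ A) ≡ subL σ (outs m A)
outs-subA m σ A rewrite length-subL σ (args A) = pick-subL Out _ σ (args A)

∈-ins⇒∈-atomVars : ∀ m A {z} → z ∈ varsL (ins m A) → z ∈ atomVars A
∈-ins⇒∈-atomVars m A = ∈-varsL-pick⁻ In _ (args A)

∈-outs⇒∈-atomVars : ∀ m A {z} → z ∈ varsL (outs m A) → z ∈ atomVars A
∈-outs⇒∈-atomVars m A = ∈-varsL-pick⁻ Out _ (args A)

modeEqns : ℕ → ℕ → (ℕ → Mode) → List Term → List Term → List OEqn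
modeEqns ri ro f (a ∷ as) (h ∷ hs) with f 0
... | In = orient true ri a h ∷ modeEqns ri ro (λ i → f (suc i)) as hs
... | Out = orient false ro a h ∷ modeEqns ri ro (λ i → f (suc i)) as hs
modeEqns ri ro f _ _ = []

map-toEqn-modeEqns : ∀ ri ro f as hs → map toEqn (modeEqns ri ro f as hs) ≡ zip as hs
map-toEqn-modeEqns ri ro f [] hs = refl
map-toEqn-modeEqns ri ro f (a ∷ as) [] = refl
map-toEqn-modeEqns ri ro f (a ∷ as) (h ∷ hs) with f 0
... | In = cong (_ ∷_) (map-toEqn-modeEqns ri ro _ as hs)
... | Out = cong (_ ∷_) (map-toEqn-modeEqns ri ro _ as hs)

∈-modeEqns⁻ : ∀ ri ro f as hs {e} → e ∈ map toBlock (modeEqns ri ro f as hs) →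
  (∃₂ λ a h → e ≡ block (a ∷ []) (h ∷ []) ri × a ∈ pick In f as × h ∈ pick In f hs) ⊎
  (∃₂ λ a h → e ≡ block (h ∷ []) (a ∷ []) ro × h ∈ pick Out f hs × a ∈ pick Out f as)
∈-modeEqns⁻ ri ro f (a ∷ as) (h ∷ hs) m with f 0
∈-modeEqns⁻ ri ro f (a ∷ as) (h ∷ hs) (here refl) | In = inj₁ (a , h , refl , here refl , here refl)
∈-modeEqns⁻ ri ro f (a ∷ as) (h ∷ hs) (there m) | In with ∈-modeEqns⁻ ri ro _ as hs m
... | inj₁ (a′ , h′ , e , p , q) = inj₁ (a′ , h′ , e , there p , there q)
... | inj₂ r = inj₂ r
∈-modeEqns⁻ ri ro f (a ∷ as) (h ∷ hs) (here refl) | Out = inj₂ (a , h , refl , here refl , here refl)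
∈-modeEqns⁻ ri ro f (a ∷ as) (h ∷ hs) (there m) | Out with ∈-modeEqns⁻ ri ro _ as hs m
... | inj₁ r = inj₁ r
... | inj₂ (a′ , h′ , e , p , q) = inj₂ (a′ , h′ , e , there p , there q)

∈-allRhsVars-modeEqns⁻ : ∀ ri ro f as hs {z} → z ∈ allRhsVars (map toBlock (modeEqns ri ro f as hs)) →
  z ∈ varsL (pick In f hs) ⊎ z ∈ varsL (pick Out f as)
∈-allRhsVars-modeEqns⁻ ri ro f (a ∷ as) (h ∷ hs) p with f 0
... | In with ∈-++⁻ (varsL (h ∷ [])) p
...   | inj₁ q = inj₁ (∈-++⁺ˡ (subst (_ ∈_) varsL-[ h ] q))
...   | inj₂ q = [ inj₁ ∘ ∈-++⁺ʳ (varsT h) , inj₂ ]′ (∈-allRhsVars-modeEqns⁻ ri ro _ as hs q)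
∈-allRhsVars-modeEqns⁻ ri ro f (a ∷ as) (h ∷ hs) p | Out with ∈-++⁻ (varsL (a ∷ [])) p
...   | inj₁ q = inj₂ (∈-++⁺ˡ (subst (_ ∈_) varsL-[ a ] q))
...   | inj₂ q = [ inj₁ , inj₂ ∘ ∈-++⁺ʳ (varsT a) ]′ (∈-allRhsVars-modeEqns⁻ ri ro _ as hs q)

Unique-modeEqns : ∀ ri ro f as hs → Unique (varsL (pick In f hs)) → Unique (varsL (pick Out f as)) →
  varsL as # varsL hs → Unique (allRhsVars (map toBlock (modeEqns ri ro f as hs)))
Unique-modeEqns ri ro f [] hs _ _ _ = []
Unique-modeEqns ri ro f (a ∷ as) [] _ _ _ = []
Unique-modeEqns ri ro f (a ∷ as) (h ∷ hs) ui uo d with f 0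
... | In with Unique-++⁻ (varsT h) ui
...   | uh , ui′ , dh =
  Unique-++⁺ (subst Unique (sym varsL-[ h ]) uh) (Unique-modeEqns ri ro _ as hs ui′ uo d′)
    (λ p q → [ dh (subst (_ ∈_) varsL-[ h ] p)
             , (λ r → d (∈-++⁺ʳ (varsT a) (∈-varsL-pick⁻ Out _ as r)) (∈-++⁺ˡ (subst (_ ∈_) varsL-[ h ] p))) ]′
             (∈-allRhsVars-modeEqns⁻ ri ro _ as hs q))
  where
  d′ : varsL as # varsL hs
  d′ p q = d (∈-++⁺ʳ (varsT a) p) (∈-++⁺ʳ (varsT h) q)
Unique-modeEqns ri ro f (a ∷ as) (h ∷ hs) ui uo d | Out with Unique-++⁻ (varsT a) uo
...   | ua , uo′ , da =
  Unique-++⁺ (subst Unique (sym varsL-[ a ]) ua) (Unique-modeEqns ri ro _ as hs ui uo′ d′)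
    (λ p q → [ (λ r → d (∈-++⁺ˡ (subst (_ ∈_) varsL-[ a ] p)) (∈-++⁺ʳ (varsT h) (∈-varsL-pick⁻ In _ hs r)))
             , da (subst (_ ∈_) varsL-[ a ] p) ]′
             (∈-allRhsVars-modeEqns⁻ ri ro _ as hs q))
  where
  d′ : varsL as # varsL hs
  d′ p q = d (∈-++⁺ʳ (varsT a) p) (∈-++⁺ʳ (varsT h) q)

Stratified-modeEqns : ∀ f as hs → Unique (varsL (pick In f hs)) → Unique (varsL (pick Out f as)) →
  varsL as # varsL hs → varsL (pick In f as) # varsL (pick Out f as) →
  Stratified (map toBlock (modeEqns 0 1 f as hs))
Stratified-modeEqns f as hs ui uo d s = Unique-modeEqns 0 1 f as hs ui uo d , layered
  where
  inA : ∀ md {t z} → t ∈ pick md f as → z ∈ varsT t → z ∈ varsL as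
  inA md m p = ∈-varsL-pick⁻ md f as (∈-varsL⁺ m p)
  inH : ∀ md {t z} → t ∈ pick md f hs → z ∈ varsT t → z ∈ varsL hs
  inH md m p = ∈-varsL-pick⁻ md f hs (∈-varsL⁺ m p)
  layered : Layered (map toBlock (modeEqns 0 1 f as hs))
  layered ma mb le p q with ∈-modeEqns⁻ 0 1 f as hs ma | ∈-modeEqns⁻ 0 1 f as hs mb
  ... | inj₁ (a , _ , refl , ma′ , _) | inj₁ (_ , h₂ , refl , _ , mh₂) =
    d (inA In ma′ (subst (_ ∈_) varsL-[ a ] p)) (inH In mh₂ (subst (_ ∈_) varsL-[ h₂ ] q))
  ... | inj₁ (a , _ , refl , ma′ , _) | inj₂ (a₂ , _ , refl , _ , ma₂) =
    s (∈-varsL⁺ ma′ (subst (_ ∈_) varsL-[ a ] p)) (∈-varsL⁺ ma₂ (subst (_ ∈_) varsL-[ a₂ ] q))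
  ... | inj₂ (_ , _ , refl , _ , _) | inj₁ (_ , _ , refl , _ , _) with le
  ...   | ()
  layered ma mb le p q | inj₂ (_ , h , refl , mh , _) | inj₂ (a₂ , _ , refl , _ , ma₂) =
    d (inA Out ma₂ (subst (_ ∈_) varsL-[ a₂ ] q)) (inH Out mh (subst (_ ∈_) varsL-[ h ] p))

-- Input positions are read A ≐ H and output positions H ≐ A, the latter at the higher rank.
NSTO-atom≐head : ∀ m A H → SamePred A H →
  Unique (varsL (outs m A)) → varsL (ins m A) # varsL (outs m A) →
  Unique (varsL (ins m H)) → atomVars A # atomVars H →
  NSTO ((atomTerm A , atomTerm H) ∷ [])
NSTO-atom≐head m (atom p as) (atom q hs) (refl , len) uo s ui d =
  NSTO-fn≐fn (modeEqns 0 1 f as hs , map-toEqn-modeEqns 0 1 f as hs ,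
    Stratified-modeEqns f as hs (subst (λ n → Unique (varsL (pick In (m p n) hs))) (sym len) ui) uo d s)
  where f = m p (length as)

-- A unification algorithm guided by a known unifier θ

Unifies : Subst → OEqn → Set
Unifies τ a = sub τ (left a) ≡ sub τ (right a)

All-Unifies-cong : ∀ {τ τ′} → (∀ y → τ y ≡ τ′ y) → ∀ os → All (Unifies τ) os → All (Unifies τ′) os
All-Unifies-cong h [] [] = []
All-Unifies-cong h (a ∷ os) (p ∷ ps) =
  trans (sym (sub-cong (left a) (λ {y} _ → h y))) (trans p (sub-cong (right a) (λ {y} _ → h y))) ∷ All-Unifies-cong h os ps

zipOriented-unifies : ∀ τ k ls rs → subL τ ls ≡ subL τ rs → All (Unifies τ) (zipOriented true k ls rs)
zipOriented-unifies τ k [] rs e = []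
zipOriented-unifies τ k (l ∷ ls) (r ∷ rs) e with ∷-injective e
... | e₁ , e₂ = e₁ ∷ zipOriented-unifies τ k ls rs e₂

zipOriented-unifies⁻ : ∀ τ k ls rs → length ls ≡ length rs → All (Unifies τ) (zipOriented true k ls rs) →
  subL τ ls ≡ subL τ rs
zipOriented-unifies⁻ τ k [] [] _ _ = refl
zipOriented-unifies⁻ τ k (l ∷ ls) (r ∷ rs) len (p ∷ ps) = cong₂ _∷_ p (zipOriented-unifies⁻ τ k ls rs (suc-injective len) ps)

modeEqns-unifies : ∀ τ ri ro f as hs → subL τ as ≡ subL τ hs → All (Unifies τ) (modeEqns ri ro f as hs)
modeEqns-unifies τ ri ro f [] hs e = []
modeEqns-unifies τ ri ro f (a ∷ as) (h ∷ hs) e with f 0 | ∷-injective e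
... | In | e₁ , e₂ = e₁ ∷ modeEqns-unifies τ ri ro _ as hs e₂
... | Out | e₁ , e₂ = sym e₁ ∷ modeEqns-unifies τ ri ro _ as hs e₂

modeEqns-unifies⁻ : ∀ τ ri ro f as hs → length as ≡ length hs → All (Unifies τ) (modeEqns ri ro f as hs) →
  subL τ as ≡ subL τ hs
modeEqns-unifies⁻ τ ri ro f [] [] len u = refl
modeEqns-unifies⁻ τ ri ro f (a ∷ as) (h ∷ hs) len u with f 0
modeEqns-unifies⁻ τ ri ro f (a ∷ as) (h ∷ hs) len (p ∷ ps) | In =
  cong₂ _∷_ p (modeEqns-unifies⁻ τ ri ro _ as hs (suc-injective len) ps)
modeEqns-unifies⁻ τ ri ro f (a ∷ as) (h ∷ hs) len (p ∷ ps) | Out =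
  cong₂ _∷_ (sym p) (modeEqns-unifies⁻ τ ri ro _ as hs (suc-injective len) ps)

sub-absorbs-bind : ∀ θ x t → θ x ≡ sub θ t → ∀ u → sub θ (sub (bind x t) u) ≡ sub θ u
sub-absorbs-bind θ x t e u = trans (sub-∘ (bind x t) θ u) (sub-cong u (λ {y} _ → absorbs y))
  where
  absorbs : ∀ y → sub θ (bind x t y) ≡ θ y
  absorbs y with bind-case x t y
  ... | inj₁ (refl , b) rewrite b = sym e
  ... | inj₂ (_ , b) rewrite b = refl

mutual
  size : Term → ℕ
  size (var x) = 1
  size (fn f ts) = suc (sizeL ts)

  sizeL : List Term → ℕ
  sizeL [] = 0
  sizeL (t ∷ ts) = size t + sizeL ts

-- Decomposition and elimination both decrease it, the latter because θ absorbs the binding.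
measure : Subst → List OEqn → ℕ
measure θ [] = 0
measure θ (a ∷ os) = size (sub θ (left a)) + measure θ os

measure-++ : ∀ θ os os′ → measure θ (os ++ os′) ≡ measure θ os + measure θ os′
measure-++ θ [] os′ = refl
measure-++ θ (a ∷ os) os′ =
  trans (cong (size (sub θ (left a)) +_) (measure-++ θ os os′)) (sym (+-assoc (size (sub θ (left a))) (measure θ os) (measure θ os′)))

measure-subO-bind : ∀ θ x t → θ x ≡ sub θ t → ∀ os → measure θ (map (subO (bind x t)) os) ≡ measure θ os
measure-subO-bind θ x t e [] = refl
measure-subO-bind θ x t e (oeqn o k l r ∷ os) =
  cong₂ _+_ (cong size (sub-absorbs-bind θ x t e l)) (measure-subO-bind θ x t e os)

measure-zipOriented : ∀ θ k ls rs → length ls ≡ length rs → measure θ (zipOriented true k ls rs) ≡ sizeL (subL θ ls)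
measure-zipOriented θ k [] [] _ = refl
measure-zipOriented θ k (l ∷ ls) (r ∷ rs) len = cong (size (sub θ l) +_) (measure-zipOriented θ k ls rs (suc-injective len))

size-positive : ∀ t → 1 ≤ size t
size-positive (var x) = s≤s z≤n
size-positive (fn f ts) = s≤s z≤n

RankedAtom : Set
RankedAtom = Atom × ℕ

atomBlock : Moding → RankedAtom → Block
atomBlock m (A , k) = block (ins m A) (outs m A) k

subRanked : Subst → RankedAtom → RankedAtom
subRanked σ (A , k) = subA σ A , k

atomBlock-sub : ∀ m σ p → atomBlock m (subRanked σ p) ≡ subB σ (atomBlock m p)
atomBlock-sub m σ (A , k) = cong₂ (λ a b → block a b k) (ins-subA m σ A) (outs-subA m σ A)

map-atomBlock-sub-∘ : ∀ m σ ψ ps →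
  map (atomBlock m) (map (subRanked (σ ∘ₛ ψ)) ps) ≡ map (subB σ) (map (atomBlock m) (map (subRanked ψ) ps))
map-atomBlock-sub-∘ m σ ψ [] = refl
map-atomBlock-sub-∘ m σ ψ ((A , k) ∷ ps) = cong₂ _∷_
  (trans (cong (λ B → atomBlock m (B , k)) (cong (atom (pred A)) (sym (subL-∘ ψ σ (args A)))))
         (atomBlock-sub m σ (subA ψ A , k)))
  (map-atomBlock-sub-∘ m σ ψ ps)

-- x ↦ t, introduced at rank N
Binding : Set
Binding = ℕ × Term × ℕ

solvedEqn : Binding → OEqn
solvedEqn (x , t , N) = oeqn false N t (var x)

subBinding : Subst → Binding → Binding
subBinding σ (x , t , N) = x , sub σ t , N

bindingsSubst : List Binding → Subst
bindingsSubst [] y = var y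
bindingsSubst ((x , t , N) ∷ S) y with y ≟ x
... | yes _ = t
... | no _ = bindingsSubst S y

bindingsSubst-∉ : ∀ S y → y ∉ map proj₁ S → bindingsSubst S y ≡ var y
bindingsSubst-∉ [] y _ = refl
bindingsSubst-∉ ((x , t , N) ∷ S) y y∉ with y ≟ x
... | yes refl = ⊥-elim (y∉ (here refl))
... | no _ = bindingsSubst-∉ S y (y∉ ∘ there)

bindingsSubst-∈ : ∀ S {x t N} → Unique (map proj₁ S) → (x , t , N) ∈ S → bindingsSubst S x ≡ t
bindingsSubst-∈ ((x′ , t′ , N′) ∷ S) {x} u (here refl) with x ≟ x′
... | yes _ = refl
... | no x≢x = ⊥-elim (x≢x refl)
bindingsSubst-∈ ((x′ , t′ , N′) ∷ S) {x} u (there m) with x ≟ x′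
... | yes refl = ⊥-elim (proj₁ (Unique-∷⁻ u) (∈-map⁺ proj₁ m))
... | no _ = bindingsSubst-∈ S (proj₂ (Unique-∷⁻ u)) m

bindingsSubst-absorbed : ∀ θ S → All (Unifies θ) (map solvedEqn S) → ∀ y → sub θ (bindingsSubst S y) ≡ θ y
bindingsSubst-absorbed θ [] _ y = refl
bindingsSubst-absorbed θ ((x , t , N) ∷ S) (p ∷ ps) y with y ≟ x
... | yes refl = p
... | no _ = bindingsSubst-absorbed θ S ps y

bindingsSubst-finite : ∀ S → IsSubstitution (bindingsSubst S)
bindingsSubst-finite S = maxVar S , λ y le → bindingsSubst-∉ S y (λ m → below S m le)
  where
  maxVar : List Binding → ℕ
  maxVar [] = 0
  maxVar ((x , _ , _) ∷ S) = suc x ⊔ maxVar S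
  below : ∀ S {y} → y ∈ map proj₁ S → maxVar S ≤ y → ⊥
  below ((x , _ , _) ∷ S) (here refl) le = <-irrefl refl (≤-trans (m≤m⊔n (suc x) (maxVar S)) le)
  below ((x , _ , _) ∷ S) (there m) le = below S m (≤-trans (m≤n⊔m (suc x) (maxVar S)) le)

allRhsVars-solved : ∀ S → allRhsVars (map toBlock (map solvedEqn S)) ≡ map proj₁ S
allRhsVars-solved [] = refl
allRhsVars-solved ((x , t , N) ∷ S) = cong (x ∷_) (allRhsVars-solved S)

-- The solver transforms the pending equations U into bindings S, applying the accumulated
-- substitution ψ to a fixed list of ranked atoms as it goes, while keeping the whole system
-- stratified.  The unifier θ of the initial equations E₀ rules out clashes and bounds the run.
module Solver (m : Moding) (atoms : List RankedAtom) (E₀ : List OEqn) (θ : Subst) where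

  fixedBlocks : Subst → List Binding → List Block
  fixedBlocks ψ S = map (atomBlock m) (map (subRanked ψ) atoms) ++ map toBlock (map solvedEqn S)

  systemBlocks : Subst → List Binding → List OEqn → List Block
  systemBlocks ψ S U = fixedBlocks ψ S ++ map toBlock U

  record State (ψ : Subst) (S : List Binding) (U : List OEqn) : Set where
    field
      stratified : Stratified (systemBlocks ψ S U)
      solved-fresh : ∀ {x t N} → (x , t , N) ∈ S → ∀ {e} → e ∈ systemBlocks ψ S U → x ∉ lhsVars e
      absorbs : ∀ y → sub θ (ψ y) ≡ θ y
      unifies-solved : All (Unifies θ) (map solvedEqn S)
      unifies-pending : All (Unifies θ) U
      complete : ∀ τ → All (Unifies τ) (map solvedEqn S) → All (Unifies τ) U → All (Unifies (τ ∘ₛ ψ)) E₀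
      finite : IsSubstitution ψ

  ∈-fixedBlocks-solved : ∀ ψ S {b} → b ∈ S → toBlock (solvedEqn b) ∈ fixedBlocks ψ S
  ∈-fixedBlocks-solved ψ S mS = ∈-++⁺ʳ (map (atomBlock m) (map (subRanked ψ) atoms)) (∈-map⁺ toBlock (∈-map⁺ solvedEqn mS))

  decompose-step : ∀ ψ S o k f g ls rs U → State ψ S (oeqn o k (fn f ls) (fn g rs) ∷ U) →
    State ψ S (zipOriented true k ls rs ++ U) ×
    measure θ (zipOriented true k ls rs ++ U) < measure θ (oeqn o k (fn f ls) (fn g rs) ∷ U)
  decompose-step ψ S o k f g ls rs U st = st′ , smaller
    where
    open State st
    X = fixedBlocks ψ S
    Y = map toBlock U
    f≡g = proj₁ (fn-injective (All.head unifies-pending))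
    args-unified = proj₂ (fn-injective (All.head unifies-pending))
    len : length ls ≡ length rs
    len = subL-unifier⇒length≡ args-unified
    blocks≡ : systemBlocks ψ S (zipOriented true k ls rs ++ U) ≡ X ++ zipBlocks k ls rs ++ Y
    blocks≡ = cong (X ++_) (trans (map-++ toBlock (zipOriented true k ls rs) U)
                                  (cong (_++ Y) (proj₁ (map-toBlock-zipOriented k ls rs))))
    st′ : State ψ S (zipOriented true k ls rs ++ U)
    State.stratified st′ = subst Stratified (sym blocks≡) (Stratified-decompose X Y len stratified)
    State.solved-fresh st′ mS me p with zipBlocks-covers X Y (subst (_ ∈_) blocks≡ me)
    ... | _ , me′ , _ , lhs⊆ , _ = solved-fresh mS me′ (lhs⊆ p)
    State.absorbs st′ = absorbs
    State.unifies-solved st′ = unifies-solved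
    State.unifies-pending st′ = AllP.++⁺ (zipOriented-unifies θ k ls rs args-unified) (All.tail unifies-pending)
    State.complete st′ τ us uz with AllP.++⁻ (zipOriented true k ls rs) uz
    ... | uz₁ , uz₂ = complete τ us (cong₂ fn f≡g (zipOriented-unifies⁻ τ k ls rs len uz₁) ∷ uz₂)
    State.finite st′ = finite
    smaller : measure θ (zipOriented true k ls rs ++ U) < measure θ (oeqn o k (fn f ls) (fn g rs) ∷ U)
    smaller rewrite measure-++ θ (zipOriented true k ls rs) U | measure-zipOriented θ k ls rs len =
      +-monoˡ-< (measure θ U) (n<1+n (sizeL (subL θ ls)))

  data VarSide (a : OEqn) (x : ℕ) (t : Term) : Set where
    var-left  : left a ≡ var x → right a ≡ t → VarSide a x t
    var-right : left a ≡ t → right a ≡ var x → VarSide a x t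

  map-solvedEqn-subBinding : ∀ x t S → (∀ {y u N} → (y , u , N) ∈ S → y ≢ x) →
    map toBlock (map solvedEqn (map (subBinding (bind x t)) S)) ≡ map (subB (bind x t)) (map toBlock (map solvedEqn S))
  map-solvedEqn-subBinding x t [] h = refl
  map-solvedEqn-subBinding x t ((y , u , N) ∷ S) h =
    cong₂ _∷_ (cong (λ v → block (sub (bind x t) u ∷ []) (v ∷ []) N) (sym (bind-other x t (h (here refl)))))
              (map-solvedEqn-subBinding x t S (h ∘ there))

  module EliminateStep (ψ : Subst) (S : List Binding) (a : OEqn) (U : List OEqn)
                       (x : ℕ) (t : Term) (side : VarSide a x t) (st : State ψ S (a ∷ U)) where
    open State st
    X = fixedBlocks ψ S
    Y = map toBlock U
    N = suc (maxRank (X ++ Y))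
    open Eliminate X Y x t N (s≤s ∘ maxRank-≥)
    ψ′ = σ ∘ₛ ψ
    S′ = map (subBinding σ) S ++ (x , t , N) ∷ []
    U′ = map (subO σ) U

    blockOf : VarSide a x t → Block
    blockOf (var-left _ _) = block (var x ∷ []) (t ∷ []) (level a)
    blockOf (var-right _ _) = block (t ∷ []) (var x ∷ []) (level a)

    toBlock≡blockOf : (side : VarSide a x t) → toBlock a ≡ blockOf side
    toBlock≡blockOf (var-left p q) = cong₂ (λ u v → block (u ∷ []) (v ∷ []) (level a)) p q
    toBlock≡blockOf (var-right p q) = cong₂ (λ u v → block (u ∷ []) (v ∷ []) (level a)) p q

    stratified′ : Stratified (X ++ blockOf side ∷ Y)
    stratified′ = subst (λ e → Stratified (X ++ e ∷ Y)) (toBlock≡blockOf side) stratified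

    ∈-system : ∀ {e} → e ∈ X ++ blockOf side ∷ Y → e ∈ systemBlocks ψ S (a ∷ U)
    ∈-system = subst (λ e → _ ∈ X ++ e ∷ Y) (sym (toBlock≡blockOf side))

    x∉t : x ∉ varsT t
    x∉t = go side stratified′
      where
      go : (side : VarSide a x t) → Stratified (X ++ blockOf side ∷ Y) → x ∉ varsT t
      go (var-left _ _) s p = Stratified⇒lhs#rhs s (∈-insert X) (here refl) (∈-++⁺ˡ p)
      go (var-right _ _) s p = Stratified⇒lhs#rhs s (∈-insert X) (∈-++⁺ˡ p) (here refl)

    θx≡θt : θ x ≡ sub θ t
    θx≡θt = go side (All.head unifies-pending)
      where
      go : VarSide a x t → Unifies θ a → θ x ≡ sub θ t
      go (var-left p q) h = trans (cong (sub θ) (sym p)) (trans h (cong (sub θ) q))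
      go (var-right p q) h = sym (trans (cong (sub θ) (sym p)) (trans h (cong (sub θ) q)))

    module _ {y u M} (mS : (y , u , M) ∈ S) where
      private
        solved∈ : toBlock (solvedEqn (y , u , M)) ∈ X ++ Y
        solved∈ = ∈-++⁺ˡ (∈-fixedBlocks-solved ψ S mS)

      solved≢x : y ≢ x
      solved≢x = go side stratified′ ∈-system
        where
        go : (side : VarSide a x t) → Stratified (X ++ blockOf side ∷ Y) →
             (∀ {e} → e ∈ X ++ blockOf side ∷ Y → e ∈ systemBlocks ψ S (a ∷ U)) → y ≢ x
        go (var-left _ _) _ ∈sys refl = solved-fresh mS (∈sys (∈-insert X)) (here refl)
        go (var-right _ _) s _ refl = rhsVars-apart X _ (proj₁ s) solved∈ (here refl) (here refl)

      solved∉t : y ∉ varsT t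
      solved∉t = go side stratified′ ∈-system
        where
        go : (side : VarSide a x t) → Stratified (X ++ blockOf side ∷ Y) →
             (∀ {e} → e ∈ X ++ blockOf side ∷ Y → e ∈ systemBlocks ψ S (a ∷ U)) → y ∉ varsT t
        go (var-left _ _) s _ p = rhsVars-apart X _ (proj₁ s) solved∈ (∈-++⁺ˡ p) (here refl)
        go (var-right _ _) _ ∈sys p = solved-fresh mS (∈sys (∈-insert X)) (∈-++⁺ˡ p)

    new≡ : new ≡ systemBlocks ψ′ S′ U′
    new≡ = begin
      map (subB σ) (A₀ ++ Sv) ++ solved ∷ map (subB σ) Y
        ≡⟨ cong (_++ solved ∷ map (subB σ) Y) (map-++ (subB σ) A₀ Sv) ⟩
      (map (subB σ) A₀ ++ map (subB σ) Sv) ++ solved ∷ map (subB σ) Y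
        ≡⟨ ++-assoc (map (subB σ) A₀) (map (subB σ) Sv) (solved ∷ map (subB σ) Y) ⟩
      map (subB σ) A₀ ++ (map (subB σ) Sv ++ solved ∷ map (subB σ) Y)
        ≡⟨ cong₂ (λ p q → p ++ (q ++ solved ∷ map (subB σ) Y))
                 (sym (map-atomBlock-sub-∘ m σ ψ atoms)) (sym (map-solvedEqn-subBinding x t S solved≢x)) ⟩
      A₀′ ++ (Sv₀ ++ solved ∷ map (subB σ) Y)
        ≡⟨ cong (λ q → A₀′ ++ (Sv₀ ++ solved ∷ q)) (sym (map-toBlock-subO σ U)) ⟩
      A₀′ ++ (Sv₀ ++ solved ∷ map toBlock U′)
        ≡⟨ cong (A₀′ ++_) (sym (++-assoc Sv₀ (solved ∷ []) (map toBlock U′))) ⟩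
      A₀′ ++ ((Sv₀ ++ solved ∷ []) ++ map toBlock U′)
        ≡⟨ cong (λ q → A₀′ ++ (q ++ map toBlock U′))
                (sym (trans (cong (map toBlock) (map-++ solvedEqn (map (subBinding σ) S) ((x , t , N) ∷ [])))
                            (map-++ toBlock (map solvedEqn (map (subBinding σ) S)) (solvedEqn (x , t , N) ∷ [])))) ⟩
      A₀′ ++ (map toBlock (map solvedEqn S′) ++ map toBlock U′)
        ≡⟨ sym (++-assoc A₀′ (map toBlock (map solvedEqn S′)) (map toBlock U′)) ⟩
      systemBlocks ψ′ S′ U′ ∎
      where
      open ≡-Reasoning
      A₀ = map (atomBlock m) (map (subRanked ψ) atoms)
      Sv = map toBlock (map solvedEqn S)
      A₀′ = map (atomBlock m) (map (subRanked ψ′) atoms)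
      Sv₀ = map toBlock (map solvedEqn (map (subBinding σ) S))

    stratified-new : Stratified new
    stratified-new = go side stratified′
      where
      go : (side : VarSide a x t) → Stratified (X ++ blockOf side ∷ Y) → Stratified new
      go (var-left _ _) = eliminate-var≐t (level a)
      go (var-right _ _) = eliminate-t≐var (level a)

    unifies-solved-∘σ : ∀ τ S₀ → (∀ {b} → b ∈ S₀ → b ∈ S) →
      All (Unifies τ) (map solvedEqn (map (subBinding σ) S₀)) → All (Unifies (τ ∘ₛ σ)) (map solvedEqn S₀)
    unifies-solved-∘σ τ [] _ [] = []
    unifies-solved-∘σ τ ((y , u , M) ∷ S₀) ⊆S (p ∷ ps) =
      trans (sym (sub-∘ σ τ u)) (trans p (cong (sub τ) (sym (bind-other x t (solved≢x (⊆S (here refl)))))))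
      ∷ unifies-solved-∘σ τ S₀ (⊆S ∘ there) ps

    unifies-pending-∘σ : ∀ τ U₀ → All (Unifies τ) (map (subO σ) U₀) → All (Unifies (τ ∘ₛ σ)) U₀
    unifies-pending-∘σ τ [] [] = []
    unifies-pending-∘σ τ (oeqn o k l r ∷ U₀) (p ∷ ps) = trans (sym (sub-∘ σ τ l)) (trans p (sub-∘ σ τ r)) ∷ unifies-pending-∘σ τ U₀ ps

    unifies-a-∘σ : ∀ τ → Unifies (τ ∘ₛ σ) a
    unifies-a-∘σ τ = go side
      where
      tσ : sub (τ ∘ₛ σ) t ≡ sub τ t
      tσ = trans (sym (sub-∘ σ τ t)) (cong (sub τ) (bind-fresh x t t x∉t))
      xσ : sub (τ ∘ₛ σ) (var x) ≡ sub τ t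
      xσ = cong (sub τ) (bind-self x t)
      go : VarSide a x t → Unifies (τ ∘ₛ σ) a
      go (var-left p q) rewrite p | q = trans xσ (sym tσ)
      go (var-right p q) rewrite p | q = trans tσ (sym xσ)

    θ-unifies-subO : ∀ U₀ → All (Unifies θ) U₀ → All (Unifies θ) (map (subO σ) U₀)
    θ-unifies-subO [] [] = []
    θ-unifies-subO (oeqn o k l r ∷ U₀) (p ∷ ps) =
      trans (sub-absorbs-bind θ x t θx≡θt l) (trans p (sym (sub-absorbs-bind θ x t θx≡θt r))) ∷ θ-unifies-subO U₀ ps

    θ-unifies-subBinding : ∀ S₀ → All (Unifies θ) (map solvedEqn S₀) → All (Unifies θ) (map solvedEqn (map (subBinding σ) S₀))
    θ-unifies-subBinding [] [] = []
    θ-unifies-subBinding ((y , u , M) ∷ S₀) (p ∷ ps) = trans (sub-absorbs-bind θ x t θx≡θt u) p ∷ θ-unifies-subBinding S₀ ps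

    st′ : State ψ′ S′ U′
    State.stratified st′ = subst Stratified new≡ stratified-new
    State.solved-fresh st′ {y} mS {e} me p with ∈-++⁻ (map (subBinding σ) S) mS | ∈-new⁻ (subst (e ∈_) (sym new≡) me)
    ... | inj₁ mS₁ | inj₁ refl with ∈-map⁻ (subBinding σ) mS₁
    ...   | _ , m₁ , refl = solved∉t m₁ (subst (_ ∈_) varsL-[ t ] p)
    State.solved-fresh st′ mS me p | inj₁ mS₁ | inj₂ (b , mb , refl) with ∈-map⁻ (subBinding σ) mS₁
    ...   | _ , m₁ , refl with ∈-imageVars-bind⁻ x t {lhsVars b} (subst (_ ∈_) (lhsVars-sub σ b) p)
    ...     | inj₁ (q , _) = solved-fresh m₁ (∈-system (∈-++-skip X mb _)) q
    ...     | inj₂ (q , _) = solved∉t m₁ q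
    State.solved-fresh st′ mS me p | inj₂ (here refl) | inj₁ refl = x∉t (subst (_ ∈_) varsL-[ t ] p)
    State.solved-fresh st′ mS me p | inj₂ (here refl) | inj₂ (b , _ , refl) = x∉lhsVars b x∉t p
    State.absorbs st′ y = trans (sub-absorbs-bind θ x t θx≡θt (ψ y)) (absorbs y)
    State.unifies-solved st′ =
      subst (All (Unifies θ)) (sym (map-++ solvedEqn (map (subBinding σ) S) ((x , t , N) ∷ [])))
        (AllP.++⁺ (θ-unifies-subBinding S unifies-solved) (sym θx≡θt ∷ []))
    State.unifies-pending st′ = θ-unifies-subO U (All.tail unifies-pending)
    State.complete st′ τ us uu
      with AllP.++⁻ (map solvedEqn (map (subBinding σ) S))
             (subst (All (Unifies τ)) (map-++ solvedEqn (map (subBinding σ) S) ((x , t , N) ∷ [])) us)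
    ... | us₁ , _ = All-Unifies-cong (λ y → sym (sub-∘ σ τ (ψ y))) E₀
        (complete (τ ∘ₛ σ) (unifies-solved-∘σ τ S id us₁) (unifies-a-∘σ τ ∷ unifies-pending-∘σ τ U uu))
    State.finite st′ = IsSubstitution-∘ (IsSubstitution-bind x t) finite

    smaller : measure θ U′ < measure θ (a ∷ U)
    smaller rewrite measure-subO-bind θ x t θx≡θt U = m<n+m (measure θ U) (size-positive (sub θ (left a)))

  solve : ∀ n ψ S U → measure θ U < n → State ψ S U → ∃₂ λ ψ′ S′ → State ψ′ S′ []
  solve (suc n) ψ S [] _ st = ψ , S , st
  solve (suc n) ψ S (oeqn o k (var x) r ∷ U) (s≤s lt) st =
    solve n _ _ _ (<-≤-trans smaller lt) st′
    where open EliminateStep ψ S (oeqn o k (var x) r) U x r (var-left refl refl) st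
  solve (suc n) ψ S (oeqn o k (fn f ls) (var y) ∷ U) (s≤s lt) st =
    solve n _ _ _ (<-≤-trans smaller lt) st′
    where open EliminateStep ψ S (oeqn o k (fn f ls) (var y)) U y (fn f ls) (var-right refl refl) st
  solve (suc n) ψ S (oeqn o k (fn f ls) (fn g rs) ∷ U) (s≤s lt) st with decompose-step ψ S o k f g ls rs U st
  ... | st′ , smaller = solve n _ _ _ (<-≤-trans smaller lt) st′

  module Solution (ψ : Subst) (S : List Binding) (st : State ψ S []) where
    open State st

    η = bindingsSubst S
    φ = η ∘ₛ ψ
    atomBlocks = map (atomBlock m) (map (subRanked ψ) atoms)
    solvedBlocks = map toBlock (map solvedEqn S)

    system≡ : systemBlocks ψ S [] ≡ atomBlocks ++ solvedBlocks
    system≡ = ++-identityʳ _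

    unique-system : Unique (allRhsVars atomBlocks ++ map proj₁ S)
    unique-system = subst Unique (trans (allRhsVars-++ atomBlocks solvedBlocks) (cong (allRhsVars atomBlocks ++_) (allRhsVars-solved S)))
      (subst (Unique ∘ allRhsVars) system≡ (proj₁ stratified))

    unique-solved : Unique (map proj₁ S)
    unique-solved = proj₁ (proj₂ (Unique-++⁻ (allRhsVars atomBlocks) unique-system))

    solved#atoms : allRhsVars atomBlocks # map proj₁ S
    solved#atoms = proj₂ (proj₂ (Unique-++⁻ (allRhsVars atomBlocks) unique-system))

    solved-fresh′ : ∀ {y} → y ∈ map proj₁ S → ∀ {e} → e ∈ atomBlocks ++ solvedBlocks → y ∉ lhsVars e
    solved-fresh′ q me with ∈-map⁻ proj₁ q
    ... | _ , mS , refl = solved-fresh mS (subst (_ ∈_) (sym system≡) me)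

    η-unifies-solved : All (Unifies η) (map solvedEqn S)
    η-unifies-solved = go S id
      where
      go : ∀ S₀ → (∀ {b} → b ∈ S₀ → b ∈ S) → All (Unifies η) (map solvedEqn S₀)
      go [] _ = []
      go ((x , t , N) ∷ S₀) ⊆S =
        trans (sub-id t (λ {y} p → bindingsSubst-∉ S y (λ q →
                 solved-fresh′ q (∈-++⁺ʳ atomBlocks (∈-map⁺ toBlock (∈-map⁺ solvedEqn (⊆S (here refl))))) (∈-++⁺ˡ p))))
              (sym (bindingsSubst-∈ S unique-solved (⊆S (here refl))))
        ∷ go S₀ (⊆S ∘ there)

    φ-unifies : All (Unifies φ) E₀
    φ-unifies = complete η η-unifies-solved []

    φ-finite : IsSubstitution φ
    φ-finite = IsSubstitution-∘ (bindingsSubst-finite S) finite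

    θ-absorbs-φ : ∀ y → sub θ (φ y) ≡ θ y
    θ-absorbs-φ y = trans (sub-∘ η θ (ψ y)) (trans (sub-cong (ψ y) (λ {w} _ → bindingsSubst-absorbed θ S unifies-solved w)) (absorbs y))

    stratified-atoms : Stratified atomBlocks
    stratified-atoms = Stratified-++⁻ˡ atomBlocks (subst Stratified system≡ stratified)

    -- Solved variables occur in no atom.
    φ≗ψ-on-atoms : map (subRanked φ) atoms ≡ map (subRanked ψ) atoms
    φ≗ψ-on-atoms = go atoms id
      where
      go : ∀ ps → (∀ {p} → p ∈ ps → p ∈ atoms) → map (subRanked φ) ps ≡ map (subRanked ψ) ps
      go [] _ = refl
      go ((A , k) ∷ ps) ⊆atoms = cong₂ _∷_
        (cong (λ l → atom (pred A) l , k)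
          (trans (sym (subL-∘ ψ η (args A))) (subL-id (subL ψ (args A)) (λ {y} p → bindingsSubst-∉ S y (apart p)))))
        (go ps (⊆atoms ∘ there))
        where
        me = ∈-map⁺ (atomBlock m) (∈-map⁺ (subRanked ψ) (⊆atoms (here refl)))
        apart : ∀ {y} → y ∈ varsL (subL ψ (args A)) → y ∉ map proj₁ S
        apart p yS with ∈-varsL-pick-In⊎Out (m (pred A) (length (subL ψ (args A)))) (subL ψ (args A)) p
        ... | inj₁ q = solved-fresh′ yS (∈-++⁺ˡ me) q
        ... | inj₂ q = solved#atoms (∈-allRhsVars⁺ me q) yS

-- Resolution preserves rankability

Ranked : Moding → Query → Set
Ranked m Q = ∃ λ RQ → map proj₁ RQ ≡ Q × Stratified (map (atomBlock m) RQ)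

allRhsVars-atomBlocks : ∀ m RQ → allRhsVars (map (atomBlock m) RQ) ≡ varsL (concatMap (outs m) (map proj₁ RQ))
allRhsVars-atomBlocks m [] = refl
allRhsVars-atomBlocks m ((A , k) ∷ RQ) =
  trans (cong (varsL (outs m A) ++_) (allRhsVars-atomBlocks m RQ)) (sym (varsL-++ (outs m A) (concatMap (outs m) (map proj₁ RQ))))

Unique-imageVars⁻ : ∀ δ xs → (∀ {w} → w ∈ xs → IsVar (δ w)) → Unique (imageVars δ xs) → Unique xs
Unique-imageVars⁻ δ [] _ _ = []
Unique-imageVars⁻ δ (w ∷ xs) isVar u with isVar (here refl)
... | w′ , e with Unique-++⁻ (varsT (δ w)) u
... | _ , u₂ , d = Unique-∷⁺ (λ m → d w′∈δw (∈-imageVars⁺ δ m w′∈δw)) (Unique-imageVars⁻ δ xs (isVar ∘ there) u₂)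
  where
  w′∈δw : w′ ∈ varsT (δ w)
  w′∈δw = subst (λ v → w′ ∈ varsT v) (sym e) (here refl)

-- A substitution that renames variables can only merge variables, so it reflects stratification.
Stratified-subB⁻ : ∀ δ es → (∀ {e w} → e ∈ es → w ∈ lhsVars e ⊎ w ∈ rhsVars e → IsVar (δ w)) →
  Stratified (map (subB δ) es) → Stratified es
Stratified-subB⁻ δ es isVar (u , layered) =
  Unique-imageVars⁻ δ (allRhsVars es) (λ m → let (e , me , r) = ∈-allRhsVars⁻ es m in isVar me (inj₂ r))
    (subst Unique (allRhsVars-sub δ es) u) ,
  λ {a} {b} ma mb le {z} p q → let (w , ew) = isVar ma (inj₁ p) ; w∈δz = subst (λ v → w ∈ varsT v) (sym ew) (here refl) in
    layered (∈-map⁺ (subB δ) ma) (∈-map⁺ (subB δ) mb) le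
      (subst (w ∈_) (sym (lhsVars-sub δ a)) (∈-imageVars⁺ δ p w∈δz))
      (subst (w ∈_) (sym (rhsVars-sub δ b)) (∈-imageVars⁺ δ q w∈δz))

-- If φ = δ ∘ θ and θ ∘ φ = θ then θ ∘ δ fixes every θ-image, so δ maps their variables to variables.
absorbed⇒IsVar : ∀ (θ φ δ : Subst) → (∀ y → sub θ (φ y) ≡ θ y) → (∀ y → φ y ≡ sub δ (θ y)) →
  ∀ y {w} → w ∈ varsT (θ y) → IsVar (δ w)
absorbed⇒IsVar θ φ δ absorbs factor y {w} p = sub≡var⇒IsVar θ (δ w) (sub-id⁻ (θ y) θδθ≡θ p)
  where
  θδθ≡θ : sub (θ ∘ₛ δ) (θ y) ≡ θ y
  θδθ≡θ = trans (sym (sub-∘ δ θ (θ y))) (trans (cong (sub θ) (sym (factor y))) (absorbs y))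

splitAt : ∀ (RQ : List RankedAtom) Q → map proj₁ RQ ≡ Q → (i : Fin (length Q)) →
  ∃₂ λ RX k → ∃ λ RY → RQ ≡ RX ++ (lookup Q i , k) ∷ RY ×
    map proj₁ RX ≡ take (toℕ i) Q × map proj₁ RY ≡ drop (suc (toℕ i)) Q
splitAt ((A , k) ∷ RQ) _ refl fzero = [] , k , RQ , refl , refl , refl
splitAt ((A , k) ∷ RQ) _ refl (fsuc i) with splitAt RQ (map proj₁ RQ) refl i
... | RX , k′ , RY , e , e₁ , e₂ = (A , k) ∷ RX , k′ , RY , cong ((A , k) ∷_) e , cong (A ∷_) e₁ , e₂

rerank : (ℕ → ℕ) → List RankedAtom → List RankedAtom
rerank g = map (λ (A , k) → A , g k)

allRhsVars-rerank : ∀ m g R → allRhsVars (map (atomBlock m) (rerank g R)) ≡ allRhsVars (map (atomBlock m) R)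
allRhsVars-rerank m g [] = refl
allRhsVars-rerank m g ((A , k) ∷ R) = cong (varsL (outs m A) ++_) (allRhsVars-rerank m g R)

map-proj₁-rerank : ∀ g R → map proj₁ (rerank g R) ≡ map proj₁ R
map-proj₁-rerank g [] = refl
map-proj₁-rerank g ((A , k) ∷ R) = cong (A ∷_) (map-proj₁-rerank g R)

∈-rerank⁻ : ∀ g R {p} → p ∈ rerank g R → ∃₂ λ A k → (A , k) ∈ R × p ≡ (A , g k)
∈-rerank⁻ g R m with ∈-map⁻ (λ (A , k) → A , g k) m
... | (A , k) , mm , refl = A , k , mm , refl

-- The slot q·K of the selected atom is refined into its input equations (q·K), the body atoms
-- of rank b (q·K + 1 + b), and its output equations (q·K + M + 2), all below (q+1)·K.
module Slots (M : ℕ) where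
  K = suc (suc (suc M))

  outRank : ℕ → ℕ
  outRank q = q * K + suc (suc M)

  bodyRank : ℕ → ℕ → ℕ
  bodyRank q b = q * K + suc b

  slot-≤ : ∀ q q′ → q * K ≤ q′ * K → q ≤ q′
  slot-≤ q q′ = *-cancelʳ-≤ q q′ K

  slot≤outRank : ∀ q q′ → q * K ≤ outRank q′ → q ≤ q′
  slot≤outRank q q′ le with q ≤? q′
  ... | yes q≤q′ = q≤q′
  ... | no q≰q′ = ⊥-elim (<-irrefl refl (+-cancelˡ-≤ (q′ * K) K (suc (suc M))
          (subst (_≤ outRank q′) (+-comm K (q′ * K)) (≤-trans (*-monoˡ-≤ K (≰⇒> q≰q′)) le))))

  bodyRank≰slot : ∀ q b → bodyRank q b ≤ q * K → ⊥
  bodyRank≰slot q b = m+1+n≰m (q * K)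

  outRank≰slot : ∀ q → outRank q ≤ q * K → ⊥
  outRank≰slot q = m+1+n≰m (q * K)

  outRank≰bodyRank : ∀ q b → b ≤ M → outRank q ≤ bodyRank q b → ⊥
  outRank≰bodyRank q b b≤M le with +-cancelˡ-≤ (q * K) _ _ le
  ... | s≤s h = <⇒≱ (s≤s b≤M) h

  bodyRank-≤ : ∀ q b b′ → bodyRank q b ≤ bodyRank q b′ → b ≤ b′
  bodyRank-≤ q b b′ le with +-cancelˡ-≤ (q * K) _ _ le
  ... | s≤s h = h

RankedClause : Moding → Clause → Set
RankedClause m (H ⇐ B) =
  Ranked m B × Unique (varsL (ins m H)) × (∀ x → x ∈ varsL (ins m H) → x ∉ varsL (concatMap (outs m) B))

∈-queryVars⁺ : ∀ {A Q z} → A ∈ Q → z ∈ atomVars A → z ∈ queryVars Q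
∈-queryVars⁺ {Q = A ∷ Q} (here refl) p = ∈-++⁺ˡ p
∈-queryVars⁺ {Q = A ∷ Q} (there m) p = ∈-++⁺ʳ (atomVars A) (∈-queryVars⁺ m p)

module Resolvent (m : Moding) (Q : Query) (i : Fin (length Q)) (H : Atom) (B : Query) (θ : Subst)
  (rankedQ : Ranked m Q) (rankedC : RankedClause m (H ⇐ B))
  (apart : Disjoint (clauseVars (H ⇐ B)) (queryVars Q)) (mgu : MGU θ (lookup Q i) H) where

  RQ = proj₁ rankedQ
  RQ≡Q = proj₁ (proj₂ rankedQ)
  stratQ = proj₂ (proj₂ rankedQ)
  RB = proj₁ (proj₁ rankedC)
  RB≡B = proj₁ (proj₂ (proj₁ rankedC))
  stratB = proj₂ (proj₂ (proj₁ rankedC))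
  H-input-linear = proj₁ (proj₂ rankedC)
  H#B = proj₂ (proj₂ rankedC)
  θ-unifies = proj₁ (proj₂ mgu)
  θ-general = proj₂ (proj₂ mgu)

  A = lookup Q i

  private
    parts = splitAt RQ Q RQ≡Q i
  RX = proj₁ parts
  a = proj₁ (proj₂ parts)
  RY = proj₁ (proj₂ (proj₂ parts))
  RQ≡ : RQ ≡ RX ++ (A , a) ∷ RY
  RQ≡ = proj₁ (proj₂ (proj₂ (proj₂ parts)))
  RX≡ = proj₁ (proj₂ (proj₂ (proj₂ (proj₂ parts))))
  RY≡ = proj₂ (proj₂ (proj₂ (proj₂ (proj₂ parts))))

  M = maxRank (map (atomBlock m) RB)
  open Slots M

  f = m (pred A) (length (args A))
  atoms₀ = rerank (_* K) RX ++ rerank (bodyRank a) RB ++ rerank (_* K) RY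
  eqns₀ = modeEqns (a * K) (outRank a) f (args A) (args H)
  system₀ = map (atomBlock m) atoms₀ ++ map toBlock eqns₀

  pred≡ : pred A ≡ pred H
  pred≡ = proj₁ (fn-injective θ-unifies)
  args-unified : subL θ (args A) ≡ subL θ (args H)
  args-unified = proj₂ (fn-injective θ-unifies)
  length≡ : length (args A) ≡ length (args H)
  length≡ = subL-unifier⇒length≡ args-unified

  ins-H : ins m H ≡ pick In f (args H)
  ins-H rewrite pred≡ | length≡ = refl

  QV = queryVars Q
  CV = clauseVars (H ⇐ B)

  CV#QV : ∀ {z} → z ∈ CV → z ∈ QV → ⊥
  CV#QV p q = apart _ p q

  ∈-RQ : ∀ {p} → p ∈ RX ++ RY → p ∈ RQ
  ∈-RQ mp = subst (_ ∈_) (sym RQ≡) (∈-++-skip RX mp _)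

  A∈RQ : (A , a) ∈ RQ
  A∈RQ = subst ((A , a) ∈_) (sym RQ≡) (∈-insert RX)

  ∈QV : ∀ {A′ k z} → (A′ , k) ∈ RQ → z ∈ atomVars A′ → z ∈ QV
  ∈QV mp = ∈-queryVars⁺ (subst (_ ∈_) RQ≡Q (∈-map⁺ proj₁ mp))

  ∈CV : ∀ {A′ k z} → (A′ , k) ∈ RB → z ∈ atomVars A′ → z ∈ CV
  ∈CV mp p = ∈-++⁺ʳ (atomVars H) (∈-queryVars⁺ (subst (_ ∈_) RB≡B (∈-map⁺ proj₁ mp)) p)

  layeredQ : ∀ {p q} → p ∈ RQ → q ∈ RQ → proj₂ p ≤ proj₂ q → varsL (ins m (proj₁ p)) # varsL (outs m (proj₁ q))
  layeredQ mp mq = proj₂ stratQ (∈-map⁺ (atomBlock m) mp) (∈-map⁺ (atomBlock m) mq)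

  layeredB : ∀ {p q} → p ∈ RB → q ∈ RB → proj₂ p ≤ proj₂ q → varsL (ins m (proj₁ p)) # varsL (outs m (proj₁ q))
  layeredB mp mq = proj₂ stratB (∈-map⁺ (atomBlock m) mp) (∈-map⁺ (atomBlock m) mq)

  data Origin (e : Block) : Set where
    query-atom : ∀ A′ q → (A′ , q) ∈ RX ++ RY → e ≡ atomBlock m (A′ , q * K) → Origin e
    body-atom  : ∀ A′ b → (A′ , b) ∈ RB → e ≡ atomBlock m (A′ , bodyRank a b) → Origin e
    input-eqn  : ∀ s h → s ∈ pick In f (args A) → h ∈ pick In f (args H) → e ≡ block (s ∷ []) (h ∷ []) (a * K) → Origin e
    output-eqn : ∀ s h → h ∈ pick Out f (args H) → s ∈ pick Out f (args A) → e ≡ block (h ∷ []) (s ∷ []) (outRank a) → Origin e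

  origin : ∀ {e} → e ∈ system₀ → Origin e
  origin me with ∈-++⁻ (map (atomBlock m) atoms₀) me
  ... | inj₂ m₂ = [ (λ (s , h , eq , p , q) → input-eqn s h p q eq) , (λ (s , h , eq , p , q) → output-eqn s h p q eq) ]′
                    (∈-modeEqns⁻ (a * K) (outRank a) f (args A) (args H) m₂)
  ... | inj₁ m₁ with ∈-map⁻ (atomBlock m) m₁
  ...   | _ , mp , refl with ∈-++⁻ (rerank (_* K) RX) mp
  ...     | inj₁ mx with ∈-rerank⁻ (_* K) RX mx
  ...       | A′ , q , mm , refl = query-atom A′ q (∈-++⁺ˡ mm) refl
  origin me | inj₁ m₁ | _ , mp , refl | inj₂ mr with ∈-++⁻ (rerank (bodyRank a) RB) mr
  ...       | inj₁ mb with ∈-rerank⁻ (bodyRank a) RB mb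
  ...         | A′ , b , mm , refl = body-atom A′ b mm refl
  origin me | inj₁ m₁ | _ , mp , refl | inj₂ mr | inj₂ my with ∈-rerank⁻ (_* K) RY my
  ...         | A′ , q , mm , refl = query-atom A′ q (∈-++⁺ʳ RX mm) refl

  H-var∈CV : ∀ md {h z} → h ∈ pick md f (args H) → z ∈ varsL (h ∷ []) → z ∈ CV
  H-var∈CV md {h} mh p = ∈-++⁺ˡ (∈-varsL-pick⁻ md f (args H) (∈-varsL⁺ mh (subst (_ ∈_) varsL-[ h ] p)))

  A-var∈pick : ∀ md {s z} → s ∈ pick md f (args A) → z ∈ varsL (s ∷ []) → z ∈ varsL (pick md f (args A))
  A-var∈pick md {s} ms p = ∈-varsL⁺ ms (subst (_ ∈_) varsL-[ s ] p)

  A-var∈QV : ∀ md {s z} → s ∈ pick md f (args A) → z ∈ varsL (s ∷ []) → z ∈ QV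
  A-var∈QV md {s} ms p = ∈-queryVars⁺ (∈-lookup {xs = Q} i) (∈-varsL-pick⁻ md f (args A) (A-var∈pick md ms p))

  layered₀ : Layered system₀
  layered₀ ma mb le p q with origin ma | origin mb
  ... | query-atom A₁ q₁ m₁ refl | query-atom A₂ q₂ m₂ refl = layeredQ (∈-RQ m₁) (∈-RQ m₂) (slot-≤ q₁ q₂ le) p q
  ... | query-atom A₁ _ m₁ refl | body-atom A₂ _ m₂ refl =
    CV#QV (∈CV m₂ (∈-outs⇒∈-atomVars m A₂ q)) (∈QV (∈-RQ m₁) (∈-ins⇒∈-atomVars m A₁ p))
  ... | query-atom A₁ _ m₁ refl | input-eqn _ _ _ mh₂ refl = CV#QV (H-var∈CV In mh₂ q) (∈QV (∈-RQ m₁) (∈-ins⇒∈-atomVars m A₁ p))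
  ... | query-atom _ q₁ m₁ refl | output-eqn _ _ _ ms₂ refl = layeredQ (∈-RQ m₁) A∈RQ (slot≤outRank q₁ a le) p (A-var∈pick Out ms₂ q)
  ... | body-atom A₁ _ m₁ refl | query-atom A₂ _ m₂ refl =
    CV#QV (∈CV m₁ (∈-ins⇒∈-atomVars m A₁ p)) (∈QV (∈-RQ m₂) (∈-outs⇒∈-atomVars m A₂ q))
  ... | body-atom _ b₁ m₁ refl | body-atom _ b₂ m₂ refl = layeredB m₁ m₂ (bodyRank-≤ a b₁ b₂ le) p q
  ... | body-atom _ b₁ _ refl | input-eqn _ _ _ _ refl = ⊥-elim (bodyRank≰slot a b₁ le)
  ... | body-atom A₁ _ m₁ refl | output-eqn _ _ _ ms₂ refl = CV#QV (∈CV m₁ (∈-ins⇒∈-atomVars m A₁ p)) (A-var∈QV Out ms₂ q)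
  ... | input-eqn _ _ ms₁ _ refl | query-atom _ q₂ m₂ refl = layeredQ A∈RQ (∈-RQ m₂) (slot-≤ a q₂ le) (A-var∈pick In ms₁ p) q
  ... | input-eqn _ _ ms₁ _ refl | body-atom A₂ _ m₂ refl = CV#QV (∈CV m₂ (∈-outs⇒∈-atomVars m A₂ q)) (A-var∈QV In ms₁ p)
  ... | input-eqn _ _ ms₁ _ refl | input-eqn _ _ _ mh₂ refl = CV#QV (H-var∈CV In mh₂ q) (A-var∈QV In ms₁ p)
  ... | input-eqn _ _ ms₁ _ refl | output-eqn _ _ _ ms₂ refl = layeredQ A∈RQ A∈RQ ≤-refl (A-var∈pick In ms₁ p) (A-var∈pick Out ms₂ q)
  ... | output-eqn _ _ mh₁ _ refl | query-atom A₂ _ m₂ refl = CV#QV (H-var∈CV Out mh₁ p) (∈QV (∈-RQ m₂) (∈-outs⇒∈-atomVars m A₂ q))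
  ... | output-eqn _ _ _ _ refl | body-atom _ b₂ m₂ refl = ⊥-elim (outRank≰bodyRank a b₂ (maxRank-≥ (∈-map⁺ (atomBlock m) m₂)) le)
  ... | output-eqn _ _ _ _ refl | input-eqn _ _ _ _ refl = ⊥-elim (outRank≰slot a le)
  ... | output-eqn _ _ mh₁ _ refl | output-eqn _ _ _ ms₂ refl = CV#QV (H-var∈CV Out mh₁ p) (A-var∈QV Out ms₂ q)

  outsX = allRhsVars (map (atomBlock m) RX)
  outsY = allRhsVars (map (atomBlock m) RY)
  outsB = allRhsVars (map (atomBlock m) RB)
  outsA = varsL (outs m A)
  rhsE = allRhsVars (map toBlock eqns₀)

  unique-XAY : Unique (outsX ++ outsA ++ outsY)
  unique-XAY = subst Unique
    (trans (cong (allRhsVars ∘ map (atomBlock m)) RQ≡)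
      (trans (cong allRhsVars (map-++ (atomBlock m) RX ((A , a) ∷ RY)))
        (allRhsVars-++ (map (atomBlock m) RX) (atomBlock m (A , a) ∷ map (atomBlock m) RY))))
    (proj₁ stratQ)

  private
    splitX = Unique-++⁻ outsX unique-XAY
    splitAY = Unique-++⁻ outsA (proj₁ (proj₂ splitX))

  outsX#AY = proj₂ (proj₂ splitX)
  outsA#Y = proj₂ (proj₂ splitAY)

  atomRhs∈QV : ∀ R → (∀ {p} → p ∈ R → p ∈ RQ) → ∀ {z} → z ∈ allRhsVars (map (atomBlock m) R) → z ∈ QV
  atomRhs∈QV R R⊆RQ p with ∈-allRhsVars⁻ (map (atomBlock m) R) p
  ... | _ , me , q with ∈-map⁻ (atomBlock m) me
  ...   | (A′ , _) , mp , refl = ∈QV (R⊆RQ mp) (∈-outs⇒∈-atomVars m A′ q)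

  outsX∈QV : ∀ {z} → z ∈ outsX → z ∈ QV
  outsX∈QV = atomRhs∈QV RX (∈-RQ ∘ ∈-++⁺ˡ)

  outsY∈QV : ∀ {z} → z ∈ outsY → z ∈ QV
  outsY∈QV = atomRhs∈QV RY (∈-RQ ∘ ∈-++⁺ʳ RX)

  outsB∈CV : ∀ {z} → z ∈ outsB → z ∈ CV
  outsB∈CV p with ∈-allRhsVars⁻ (map (atomBlock m) RB) p
  ... | _ , me , q with ∈-map⁻ (atomBlock m) me
  ...   | (A′ , _) , mp , refl = ∈CV mp (∈-outs⇒∈-atomVars m A′ q)

  outsB∈outs-B : ∀ {z} → z ∈ outsB → z ∈ varsL (concatMap (outs m) B)
  outsB∈outs-B p = subst (λ l → _ ∈ varsL (concatMap (outs m) l)) RB≡B (subst (_ ∈_) (allRhsVars-atomBlocks m RB) p)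

  rhsE⁻ : ∀ {z} → z ∈ rhsE → z ∈ varsL (ins m H) ⊎ z ∈ outsA
  rhsE⁻ p = [ inj₁ ∘ subst (λ l → _ ∈ varsL l) (sym ins-H) , inj₂ ]′
              (∈-allRhsVars-modeEqns⁻ (a * K) (outRank a) f (args A) (args H) p)

  insH∈CV : ∀ {z} → z ∈ varsL (ins m H) → z ∈ CV
  insH∈CV p = ∈-++⁺ˡ (∈-ins⇒∈-atomVars m H p)

  unique-E : Unique rhsE
  unique-E = Unique-modeEqns (a * K) (outRank a) f (args A) (args H)
    (subst (Unique ∘ varsL) ins-H H-input-linear) (proj₁ splitAY)
    (λ p q → CV#QV (∈-++⁺ˡ q) (∈-queryVars⁺ (∈-lookup {xs = Q} i) p))

  unique-YE : Unique (outsY ++ rhsE)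
  unique-YE = Unique-++⁺ (proj₁ (proj₂ splitAY)) unique-E λ p q →
    [ (λ r → CV#QV (insH∈CV r) (outsY∈QV p)) , (λ r → outsA#Y r p) ]′ (rhsE⁻ q)

  unique-BYE : Unique (outsB ++ outsY ++ rhsE)
  unique-BYE = Unique-++⁺ (proj₁ stratB) unique-YE λ p q →
    [ (λ r → CV#QV (outsB∈CV p) (outsY∈QV r))
    , (λ r → [ (λ s → H#B _ s (outsB∈outs-B p))
             , (λ s → CV#QV (outsB∈CV p) (∈-queryVars⁺ (∈-lookup {xs = Q} i) (∈-outs⇒∈-atomVars m A s))) ]′ (rhsE⁻ r)) ]′
    (∈-++⁻ outsY q)

  unique-XBYE : Unique (outsX ++ outsB ++ outsY ++ rhsE)
  unique-XBYE = Unique-++⁺ (proj₁ splitX) unique-BYE λ p q →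
    [ (λ r → CV#QV (outsB∈CV r) (outsX∈QV p))
    , (λ r → [ (λ s → outsX#AY p (∈-++⁺ʳ outsA s))
             , (λ s → [ (λ t → CV#QV (insH∈CV t) (outsX∈QV p)) , (λ t → outsX#AY p (∈-++⁺ˡ t)) ]′ (rhsE⁻ s)) ]′
             (∈-++⁻ outsY r)) ]′
    (∈-++⁻ outsB q)

  allRhsVars-system₀ : allRhsVars system₀ ≡ outsX ++ outsB ++ outsY ++ rhsE
  allRhsVars-system₀ = begin
    allRhsVars (map (atomBlock m) atoms₀ ++ map toBlock eqns₀)
      ≡⟨ allRhsVars-++ (map (atomBlock m) atoms₀) (map toBlock eqns₀) ⟩
    allRhsVars (map (atomBlock m) atoms₀) ++ rhsE
      ≡⟨ cong (λ l → allRhsVars l ++ rhsE) (map-++₃ (atomBlock m) (rerank (_* K) RX) (rerank (bodyRank a) RB) (rerank (_* K) RY)) ⟩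
    allRhsVars (bX ++ bB ++ bY) ++ rhsE
      ≡⟨ cong (_++ rhsE) (trans (allRhsVars-++ bX (bB ++ bY)) (cong (allRhsVars bX ++_) (allRhsVars-++ bB bY))) ⟩
    (allRhsVars bX ++ allRhsVars bB ++ allRhsVars bY) ++ rhsE
      ≡⟨ cong₂ (λ u v → (u ++ v) ++ rhsE) (allRhsVars-rerank m (_* K) RX)
                (cong₂ _++_ (allRhsVars-rerank m (bodyRank a) RB) (allRhsVars-rerank m (_* K) RY)) ⟩
    (outsX ++ outsB ++ outsY) ++ rhsE
      ≡⟨ trans (++-assoc outsX (outsB ++ outsY) rhsE) (cong (outsX ++_) (++-assoc outsB outsY rhsE)) ⟩
    outsX ++ outsB ++ outsY ++ rhsE ∎
    where
    open ≡-Reasoning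
    bX = map (atomBlock m) (rerank (_* K) RX)
    bB = map (atomBlock m) (rerank (bodyRank a) RB)
    bY = map (atomBlock m) (rerank (_* K) RY)

  stratified₀ : Stratified system₀
  stratified₀ = subst Unique (sym allRhsVars-system₀) unique-XBYE , layered₀

  open Solver m atoms₀ eqns₀ θ

  map-subRanked-var : ∀ R → map (subRanked var) R ≡ R
  map-subRanked-var [] = refl
  map-subRanked-var ((A′ , k) ∷ R) = cong₂ _∷_ (cong (λ l → atom (pred A′) l , k) (subL-var (args A′))) (map-subRanked-var R)

  initial : State var [] eqns₀
  State.stratified initial = subst Stratified
    (sym (trans (cong (λ R → (map (atomBlock m) R ++ []) ++ map toBlock eqns₀) (map-subRanked-var atoms₀))
                (cong (_++ map toBlock eqns₀) (++-identityʳ _)))) stratified₀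
  State.solved-fresh initial ()
  State.absorbs initial y = refl
  State.unifies-solved initial = []
  State.unifies-pending initial = modeEqns-unifies θ (a * K) (outRank a) f (args A) (args H) args-unified
  State.complete initial τ _ u = All-Unifies-cong (λ y → refl) eqns₀ u
  State.finite initial = IsSubstitution-var

  private
    run = solve (suc (measure θ eqns₀)) var [] eqns₀ (n<1+n _) initial
  open Solution (proj₁ run) (proj₁ (proj₂ run)) (proj₂ (proj₂ run))

  φ-unifier : Unifier φ A H
  φ-unifier = cong₂ fn pred≡ (modeEqns-unifies⁻ φ (a * K) (outRank a) f (args A) (args H) length≡ φ-unifies)

  private
    factor = θ-general φ φ-finite φ-unifier
  δ = proj₁ factor
  φ≡δ∘θ : ∀ y → φ y ≡ sub δ (θ y)
  φ≡δ∘θ = proj₂ (proj₂ factor)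

  φ-atoms≡ : ∀ R → map (atomBlock m) (map (subRanked φ) R) ≡ map (subB δ) (map (atomBlock m) (map (subRanked θ) R))
  φ-atoms≡ [] = refl
  φ-atoms≡ ((A′ , k) ∷ R) = cong₂ _∷_
    (trans (cong (λ l → atomBlock m (atom (pred A′) l , k))
                 (trans (subL-cong (args A′) (λ {y} _ → φ≡δ∘θ y)) (sym (subL-∘ θ δ (args A′)))))
           (atomBlock-sub m δ (subA θ A′ , k)))
    (φ-atoms≡ R)

  δ-renames : ∀ {e w} → e ∈ map (atomBlock m) (map (subRanked θ) atoms₀) → w ∈ lhsVars e ⊎ w ∈ rhsVars e → IsVar (δ w)
  δ-renames me pw with ∈-map⁻ (atomBlock m) me
  ... | _ , mp , refl with ∈-map⁻ (subRanked θ) mp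
  ...   | (A′ , k) , _ , refl with ∈-imageVars⁻ θ (atomVars A′) (subst (_ ∈_) (varsL-subL θ (args A′))
            ([ ∈-varsL-pick⁻ In _ (subL θ (args A′)) , ∈-varsL-pick⁻ Out _ (subL θ (args A′)) ]′ pw))
  ...     | y , _ , r = absorbed⇒IsVar θ φ δ θ-absorbs-φ φ≡δ∘θ y r

  stratified-θ : Stratified (map (atomBlock m) (map (subRanked θ) atoms₀))
  stratified-θ = Stratified-subB⁻ δ _ δ-renames
    (subst Stratified (trans (cong (map (atomBlock m)) (sym φ≗ψ-on-atoms)) (φ-atoms≡ atoms₀)) stratified-atoms)

  atoms₀≡resolvent : map proj₁ (map (subRanked θ) atoms₀) ≡ map (subA θ) (replaceAt Q i B)
  atoms₀≡resolvent = begin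
    map proj₁ (map (subRanked θ) atoms₀)
      ≡⟨ map-proj₁-subRanked atoms₀ ⟩
    map (subA θ) (map proj₁ atoms₀)
      ≡⟨ cong (map (subA θ)) (map-++₃ proj₁ (rerank (_* K) RX) (rerank (bodyRank a) RB) (rerank (_* K) RY)) ⟩
    map (subA θ) (map proj₁ (rerank (_* K) RX) ++ map proj₁ (rerank (bodyRank a) RB) ++ map proj₁ (rerank (_* K) RY))
      ≡⟨ cong (map (subA θ)) (cong₂ _++_ (trans (map-proj₁-rerank (_* K) RX) RX≡)
           (cong₂ _++_ (trans (map-proj₁-rerank (bodyRank a) RB) RB≡B) (trans (map-proj₁-rerank (_* K) RY) RY≡))) ⟩
    map (subA θ) (replaceAt Q i B) ∎
    where
    open ≡-Reasoning
    map-proj₁-subRanked : ∀ R → map proj₁ (map (subRanked θ) R) ≡ map (subA θ) (map proj₁ R)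
    map-proj₁-subRanked [] = refl
    map-proj₁-subRanked ((A′ , k) ∷ R) = cong (_ ∷_) (map-proj₁-subRanked R)

  resolvent-ranked : Ranked m (map (subA θ) (replaceAt Q i B))
  resolvent-ranked = map (subRanked θ) atoms₀ , atoms₀≡resolvent , stratified-θ

-- Acyclic finite relations have a strictly monotone ranking

iterate : ∀ {n} → (Fin n → Fin n) → ℕ → Fin n → Fin n
iterate p zero x = x
iterate p (suc k) x = p (iterate p k x)

iterate-chain : ∀ {n} (E : Fin n → Fin n → Set) (p : Fin n → Fin n) → (∀ y → E (p y) y) →
  ∀ x i d → TransClosure E (iterate p (suc (d + i)) x) (iterate p i x)
iterate-chain E p pred-edge x i zero = [ pred-edge (iterate p i x) ]
iterate-chain E p pred-edge x i (suc d) = pred-edge _ ∷ iterate-chain E p pred-edge x i d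

<⇒∃-suc-+ : ∀ {i j} → i < j → ∃ λ d → j ≡ suc (d + i)
<⇒∃-suc-+ {zero} {suc j} (s≤s z≤n) = j , cong suc (sym (+-identityʳ j))
<⇒∃-suc-+ {suc i} {suc j} (s≤s lt) with <⇒∃-suc-+ lt
... | d , refl = d , cong suc (sym (+-suc d i))

TransClosure-map : ∀ {n m} {E : Fin n → Fin n → Set} {E′ : Fin m → Fin m → Set} (g : Fin m → Fin n) →
  (∀ {a b} → E′ a b → E (g a) (g b)) → ∀ {a b} → TransClosure E′ a b → TransClosure E (g a) (g b)
TransClosure-map g h [ e ] = [ h e ]
TransClosure-map g h (e ∷ t) = h e ∷ TransClosure-map g h t

-- Either some node has no predecessor, which gets rank 0 and is removed, or following
-- predecessors n + 1 times revisits a node (pigeonhole), closing a cycle.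
acyclic⇒ranking : ∀ n (E : Fin n → Fin n → Set) → (∀ i j → Dec (E i j)) → (∀ i → ¬ TransClosure E i i) →
  Σ (Fin n → ℕ) λ r → ∀ i j → E i j → r i < r j
acyclic⇒ranking zero E E? acyclic = (λ ()) , λ ()
acyclic⇒ranking (suc n) E E? acyclic with any? (λ s → all? (λ j → ¬? (E? j s)))
... | no no-source = ⊥-elim (acyclic _ cycle)
  where
  predecessor : ∀ s → ∃ λ j → E j s
  predecessor s with ¬∀⟶∃¬ (suc n) (λ j → ¬ E j s) (λ j → ¬? (E? j s)) (λ h → no-source (s , h))
  ... | j , ¬¬e = j , decidable-stable (E? j s) ¬¬e
  p : Fin (suc n) → Fin (suc n)
  p s = proj₁ (predecessor s)
  walk : Fin (suc (suc n)) → Fin (suc n)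
  walk k = iterate p (toℕ k) fzero
  collision = pigeonhole (n<1+n (suc n)) walk
  i = proj₁ collision
  j = proj₁ (proj₂ collision)
  cycle : TransClosure E (walk i) (walk i)
  cycle with <⇒∃-suc-+ (proj₁ (proj₂ (proj₂ collision)))
  ... | d , e = subst (λ w → TransClosure E w (walk i))
                  (trans (cong (λ k → iterate p k fzero) (sym e)) (sym (proj₂ (proj₂ (proj₂ collision)))))
                  (iterate-chain E p (proj₂ ∘ predecessor) fzero (toℕ i) d)
... | yes (s , source) = r , monotone
  where
  E′ : Fin n → Fin n → Set
  E′ a b = E (punchIn s a) (punchIn s b)
  rest = acyclic⇒ranking n E′ (λ a b → E? (punchIn s a) (punchIn s b))
           (λ a c → acyclic (punchIn s a) (TransClosure-map (punchIn s) id c))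
  rank′ : ∀ i → Dec (i ≡ s) → ℕ
  rank′ i (yes _) = 0
  rank′ i (no i≢s) = suc (proj₁ rest (punchOut (i≢s ∘ sym)))
  r : Fin (suc n) → ℕ
  r i = rank′ i (i ≟ᶠ s)
  monotone : ∀ i j → E i j → r i < r j
  monotone i j e with i ≟ᶠ s | j ≟ᶠ s
  ... | _ | yes refl = ⊥-elim (source i e)
  ... | yes refl | no _ = s≤s z≤n
  ... | no i≢s | no j≢s = s≤s (proj₂ rest _ _ (subst₂ E (sym (punchIn-punchOut (i≢s ∘ sym))) (sym (punchIn-punchOut (j≢s ∘ sym))) e))

-- Tidy queries and clauses are ranked

common? : (xs ys : List ℕ) → Dec (∃ λ x → x ∈ xs × x ∈ ys)
common? xs ys = map′ find (λ (_ , p , q) → lose p q) (anyᴸ? (_∈? ys) xs)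

TidyQuery⇒Ranked : ∀ m Q → TidyQuery m Q → Ranked m Q
TidyQuery⇒Ranked m Q (output-linear , acyclic) = RQ , RQ≡Q , unique , layered
  where
  ranking = acyclic⇒ranking (length Q) (Arrow m Q)
              (λ i j → common? (varsL (outs m (lookup Q i))) (varsL (ins m (lookup Q j)))) acyclic
  RQ = tabulate (λ i → lookup Q i , proj₁ ranking i)
  RQ≡Q : map proj₁ RQ ≡ Q
  RQ≡Q = trans (map-tabulate (λ i → lookup Q i , proj₁ ranking i) proj₁) (tabulate-lookup Q)
  unique : Unique (allRhsVars (map (atomBlock m) RQ))
  unique = subst Unique (sym (trans (allRhsVars-atomBlocks m RQ) (cong (varsL ∘ concatMap (outs m)) RQ≡Q))) output-linear
  layered : Layered (map (atomBlock m) RQ)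
  layered ma mb le p q with ∈-map⁻ (atomBlock m) ma | ∈-map⁻ (atomBlock m) mb
  ... | _ , mpa , refl | _ , mpb , refl with ∈-tabulate⁻ mpa | ∈-tabulate⁻ mpb
  ...   | i , refl | j , refl = <⇒≱ (proj₂ ranking j i (_ , q , p)) le

TidyClause⇒RankedClause : ∀ m c → TidyClause m c → RankedClause m c
TidyClause⇒RankedClause m (H ⇐ B) (tidy-body , input-linear , H#B) =
  TidyQuery⇒Ranked m B tidy-body , subst (Unique ∘ varsL) (++-identityʳ (ins m H)) input-linear , H#B

module _ (ρ : Renaming) where

  fwdSubst bwdSubst : Subst
  fwdSubst x = var (fwd ρ x)
  bwdSubst x = var (bwd ρ x)

  subA-bwd-fwd : ∀ A → subA bwdSubst (subA fwdSubst A) ≡ A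
  subA-bwd-fwd A = cong (atom (pred A)) (trans (subL-∘ fwdSubst bwdSubst (args A)) (subL-id (args A) (λ {y} _ → cong var (bwd-fwd ρ y))))

  ∈-varsL-bwd : ∀ ts {z} → z ∈ varsL ts → bwd ρ z ∈ varsL (subL bwdSubst ts)
  ∈-varsL-bwd ts p = subst (_ ∈_) (sym (varsL-subL bwdSubst ts)) (∈-imageVars⁺ bwdSubst p (here refl))

  outs-bwd : ∀ m B → subL bwdSubst (concatMap (outs m) B) ≡ concatMap (outs m) (map (subA bwdSubst) B)
  outs-bwd m [] = refl
  outs-bwd m (A ∷ B) = trans (subL-++ (outs m A) (concatMap (outs m) B)) (cong₂ _++_ (sym (outs-subA m bwdSubst A)) (outs-bwd m B))
    where
    subL-++ : ∀ ss ts → subL bwdSubst (ss ++ ts) ≡ subL bwdSubst ss ++ subL bwdSubst ts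
    subL-++ [] ts = refl
    subL-++ (s ∷ ss) ts = cong (_ ∷_) (subL-++ ss ts)

  map-subA-bwd-fwd : ∀ B → map (subA bwdSubst) (map (subA fwdSubst) B) ≡ B
  map-subA-bwd-fwd [] = refl
  map-subA-bwd-fwd (A ∷ B) = cong₂ _∷_ (subA-bwd-fwd A) (map-subA-bwd-fwd B)

  Ranked-rename : ∀ m B → Ranked m B → Ranked m (map (subA fwdSubst) B)
  Ranked-rename m B (RB , RB≡B , stratB) =
    map (subRanked fwdSubst) RB , trans (map-proj₁ RB) (cong (map (subA fwdSubst)) RB≡B) ,
    Stratified-subB⁻ bwdSubst _ (λ {_} {w} _ _ → bwd ρ w , refl) (subst Stratified (sym (blocks RB)) stratB)
    where
    map-proj₁ : ∀ R → map proj₁ (map (subRanked fwdSubst) R) ≡ map (subA fwdSubst) (map proj₁ R)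
    map-proj₁ [] = refl
    map-proj₁ ((A , k) ∷ R) = cong (_ ∷_) (map-proj₁ R)
    blocks : ∀ R → map (subB bwdSubst) (map (atomBlock m) (map (subRanked fwdSubst) R)) ≡ map (atomBlock m) R
    blocks [] = refl
    blocks ((A , k) ∷ R) = cong₂ _∷_
      (trans (sym (atomBlock-sub m bwdSubst (subA fwdSubst A , k))) (cong (λ A′ → atomBlock m (A′ , k)) (subA-bwd-fwd A)))
      (blocks R)

  RankedClause-rename : ∀ m c → RankedClause m c → RankedClause m (renameClause ρ c)
  RankedClause-rename m (H ⇐ B) (rankedB , input-linear , H#B) = Ranked-rename m B rankedB , input-linear′ , H#B′
    where
    H′ = subA fwdSubst H
    ins-H′ : subL bwdSubst (ins m H′) ≡ ins m H
    ins-H′ = trans (sym (ins-subA m bwdSubst H′)) (cong (ins m) (subA-bwd-fwd H))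
    input-linear′ : Unique (varsL (ins m H′))
    input-linear′ = Unique-imageVars⁻ bwdSubst (varsL (ins m H′)) (λ {w} _ → bwd ρ w , refl)
      (subst Unique (trans (cong varsL (sym ins-H′)) (varsL-subL bwdSubst (ins m H′))) input-linear)
    H#B′ : ∀ x → x ∈ varsL (ins m H′) → x ∉ varsL (concatMap (outs m) (map (subA fwdSubst) B))
    H#B′ x p q = H#B (bwd ρ x) (subst (λ l → bwd ρ x ∈ varsL l) ins-H′ (∈-varsL-bwd (ins m H′) p))
      (subst (λ l → bwd ρ x ∈ varsL l) (trans (outs-bwd m (map (subA fwdSubst) B)) (cong (concatMap (outs m)) (map-subA-bwd-fwd B)))
        (∈-varsL-bwd (concatMap (outs m) (map (subA fwdSubst) B)) q))

Unique-allRhsVars⁻ : ∀ {e es} → e ∈ es → Unique (allRhsVars es) → Unique (rhsVars e)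
Unique-allRhsVars⁻ {es = e ∷ es} (here refl) u = proj₁ (Unique-++⁻ (rhsVars e) u)
Unique-allRhsVars⁻ {es = e ∷ es} (there m) u = Unique-allRhsVars⁻ m (proj₁ (proj₂ (Unique-++⁻ (rhsVars e) u)))

Ranked-∈⇒outs-linear×ins#outs : ∀ m {Q A} → Ranked m Q → A ∈ Q → Unique (varsL (outs m A)) × varsL (ins m A) # varsL (outs m A)
Ranked-∈⇒outs-linear×ins#outs m (RQ , refl , stratified) A∈Q with ∈-map⁻ proj₁ A∈Q
... | (A , k) , mp , refl = Unique-allRhsVars⁻ me (proj₁ stratified) , Stratified⇒lhs#rhs stratified me
  where me = ∈-map⁺ (atomBlock m) mp

InTree⇒Ranked : ∀ m P R Q₀ → (∀ c → c ∈ P → TidyClause m c) → TidyQuery m Q₀ →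
  ∀ {hist Q} → InTree P R Q₀ hist Q → Ranked m Q
InTree⇒Ranked m P R Q₀ tidyP tidyQ₀ root = TidyQuery⇒Ranked m Q₀ tidyQ₀
InTree⇒Ranked m P R Q₀ tidyP tidyQ₀ (step {hist} {A} {Q} node (H ⇐ B) _ θ c∈P (ρ , refl) apart mgu) =
  Resolvent.resolvent-ranked m (A ∷ Q) (R hist A Q) _ _ θ (InTree⇒Ranked m P R Q₀ tidyP tidyQ₀ node)
    (RankedClause-rename ρ m (H ⇐ B) (TidyClause⇒RankedClause m (H ⇐ B) (tidyP (H ⇐ B) c∈P))) apart mgu

corollary4 : (m : Moding) (P : Program) (Q : Query) →
    (∀ c → c ∈ P → TidyClause m c) → TidyQuery m Q →
    (R : SelectionRule) → OccurCheckFree P Q R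
corollary4 m P Q₀ tidyP tidyQ₀ R hist A Q node (H ⇐ B) _ c∈P (ρ , refl) apart same-pred =
  NSTO-atom≐head m _ _ same-pred outs-linear ins#outs head-input-linear selected#head
  where
  selected = ∈-lookup {xs = A ∷ Q} (R hist A Q)
  selected-facts = Ranked-∈⇒outs-linear×ins#outs m (InTree⇒Ranked m P R Q₀ tidyP tidyQ₀ node) selected
  outs-linear = proj₁ selected-facts
  ins#outs = proj₂ selected-facts
  head-input-linear = proj₁ (proj₂ (RankedClause-rename ρ m (H ⇐ B) (TidyClause⇒RankedClause m (H ⇐ B) (tidyP (H ⇐ B) c∈P))))
  selected#head : atomVars (lookup (A ∷ Q) (R hist A Q)) # atomVars (subA (fwdSubst ρ) H)
  selected#head p q = apart _ (∈-++⁺ˡ q) (∈-queryVars⁺ selected p)
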